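{- Let $G$ be the graph with vertices $x_i,y_i,z_i$ ($i\in\mathbb{Z}$) and edges $\{x_i,y_i\},\{y_i,z_i\},\{z_i,x_i\},\{x_i,x_{i+1}\},\{y_i,y_{i+1}\},\{z_i,z_{i+1}\},\{x_i,y_{i+1}\},\{y_i,z_{i+1}\},\{z_i,x_{i+1}\}$ for all $i\in\mathbb{Z}$ (the cyclic 3-leg triangular ladder, infinite in both directions). Fix a configuration $T$ of $G$ in which every column is occupied (the tail type). Let $\widehat{\mathcal{C}}$ be the set of configurations $\chi$ of $G$ such that the set $\Omega(\chi)$ of occupied columns is a Dirac set and $\chi$ agrees with $T$ on all sufficiently negative columns. Then $$\widehat F(t,q):=\sum_{\chi\in\widehat{\mathcal{C}}}t^{C(\Omega(\chi))}q^{U(\Omega(\chi))}=\prod_{m=1}^{\infty}\frac{1+2q^m}{1-q^m}\sum_{n=-\infty}^{\infty}q^{n(n-1)/2}t^n.$$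
   Context: A configuration of a graph is a set of vertices no two of which are joined by an edge. Column $i$ is $\{x_i,y_i,z_i\}$; since it is a triangle, each column holds at most one particle, and $\Omega(\chi)\subset\mathbb{Z}$ is the set of indices of occupied columns. A set $\Omega\subset\mathbb{Z}$ is a Dirac set if $\Omega_e=\Omega\cap\mathbb{Z}_{\ge0}$ and $\Omega_p=\mathbb{Z}_{<0}\setminus\Omega$ are finite; its charge is $C(\Omega)=|\Omega_e|-|\Omega_p|$ and its energy is $U(\Omega)=\sum_{\alpha\in\Omega_e\cup\Omega_p}|\alpha|$. -}

module Defs where

open import Data.Bool using (Bool; true; false; _∧_; _∨_; not; if_then_else_)
open import Data.Nat as ℕ using (ℕ; zero; suc; _≥_; _≤?_; _∸_; _≡ᵇ_)
open import Data.Nat.Divisibility using (_∣?_)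
open import Data.Integer as ℤ using (ℤ; +_; -[1+_]; ∣_∣)
open import Data.Fin using (Fin; zero; suc)
open import Data.List using (List; length)
open import Data.List.Relation.Unary.All using (All)
open import Data.List.Relation.Unary.Any using (Any)
open import Data.List.Relation.Unary.AllPairs using (AllPairs)
open import Data.Product using (Σ; ∃; _×_)
open import Relation.Nullary using (¬_; does)
open import Relation.Binary.PropositionalEquality using (_≡_)

-- The graph G: vertex (i , a) with a = 0,1,2 standing for x_i, y_i, z_i.

X Y Z : Fin 3
X = zero
Y = suc zero
Z = suc (suc zero)

Vertex : Set
Vertex = ℤ × Fin 3

open import Data.Product using (_,_)

data Edge : Vertex → Vertex → Set where
  xy  : ∀ i → Edge (i , X) (i , Y)
  yz  : ∀ i → Edge (i , Y) (i , Z)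
  zx  : ∀ i → Edge (i , Z) (i , X)
  xx' : ∀ i → Edge (i , X) (ℤ.suc i , X)
  yy' : ∀ i → Edge (i , Y) (ℤ.suc i , Y)
  zz' : ∀ i → Edge (i , Z) (ℤ.suc i , Z)
  xy' : ∀ i → Edge (i , X) (ℤ.suc i , Y)
  yz' : ∀ i → Edge (i , Y) (ℤ.suc i , Z)
  zx' : ∀ i → Edge (i , Z) (ℤ.suc i , X)

VSet : Set
VSet = ℤ → Fin 3 → Bool

IsConfiguration : VSet → Set
IsConfiguration χ = ∀ i a j b → Edge (i , a) (j , b) → ¬ (χ i a ≡ true × χ j b ≡ true)

Ω : VSet → ℤ → Bool
Ω χ i = χ i X ∨ χ i Y ∨ χ i Z

-- Dirac sets.  A set S ⊆ ℤ is Dirac iff S ∩ ℤ≥0 and ℤ<0 \ S are finite,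
-- i.e. iff there is N with S ∩ ℤ≥0 ⊆ [0,N) and ℤ<0 \ S ⊆ [-N,-1].

DiracBound : (ℤ → Bool) → ℕ → Set
DiracBound S N =
  (∀ k → k ≥ N → S (+ k) ≡ false) × (∀ k → k ≥ N → S (-[1+ k ]) ≡ true)

IsDirac : (ℤ → Bool) → Set
IsDirac S = ∃ λ N → DiracBound S N

sumTo : ℕ → (ℕ → ℕ) → ℕ
sumTo zero    f = 0
sumTo (suc N) f = sumTo N f ℕ.+ f N

[_] : Bool → ℕ
[ true ]  = 1
[ false ] = 0

-- Charge and energy computed using a Dirac bound N (independent of the
-- choice of valid bound N).
-- Ω_e = { k ≥ 0 : k ∈ S },  Ω_p = { -(k+1) : k ≥ 0, -(k+1) ∉ S }.
chargeN : (ℤ → Bool) → ℕ → ℤ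
chargeN S N = + sumTo N (λ k → [ S (+ k) ])
              ℤ.- + sumTo N (λ k → [ not (S (-[1+ k ])) ])

energyN : (ℤ → Bool) → ℕ → ℕ
energyN S N = sumTo N (λ k → [ S (+ k) ] ℕ.* k)
              ℕ.+ sumTo N (λ k → [ not (S (-[1+ k ])) ] ℕ.* suc k)

DiracChargeEnergy : (ℤ → Bool) → ℤ → ℕ → Set
DiracChargeEnergy S n u =
  Σ ℕ λ N → DiracBound S N × chargeN S N ≡ n × energyN S N ≡ u

EventuallyAgree : VSet → VSet → Set
EventuallyAgree χ T = ∃ λ M → ∀ k → k ≥ M → ∀ a → χ (-[1+ k ]) a ≡ T (-[1+ k ]) a

InĈ : VSet → VSet → ℤ → ℕ → Set
InĈ T χ n u = IsConfiguration χ × EventuallyAgree χ T × DiracChargeEnergy (Ω χ) n u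

SameSet : VSet → VSet → Set
SameSet χ χ' = ∀ i a → χ i a ≡ χ' i a

HasCardinality : (VSet → Set) → ℕ → Set
HasCardinality P k =
  Σ (List VSet) λ L →
    length L ≡ k × All P L × AllPairs (λ χ χ' → ¬ SameSet χ χ') L
    × (∀ χ → P χ → Any (SameSet χ) L)

-- Formal power series in q with ℕ coefficients: coefficient functions.

FPS : Set
FPS = ℕ → ℕ

_⊛_ : FPS → FPS → FPS
(f ⊛ g) k = sumTo (suc k) (λ j → f j ℕ.* g (k ∸ j))

one : FPS
one k = if k ≡ᵇ 0 then 1 else 0

onePlusTwoQ : ℕ → FPS
onePlusTwoQ m k = if k ≡ᵇ 0 then 1 else (if k ≡ᵇ m then 2 else 0)

-- 1/(1 - q^(m+1)) = Σ_j q^((m+1) j)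
invOneMinusQ : ℕ → FPS
invOneMinusQ m k = if does (suc m ∣? k) then 1 else 0

-- factor m = (1 + 2 q^m)/(1 - q^m), for m ≥ 1 (argument is m-1)
factor : ℕ → FPS
factor m = onePlusTwoQ (suc m) ⊛ invOneMinusQ m

prodUpTo : ℕ → FPS
prodUpTo zero    = one
prodUpTo (suc K) = prodUpTo K ⊛ factor K

-- ∏_{m=1}^{∞}: factor m ≡ 1 mod q^m, so coefficient k is already
-- determined by the finite product up to m = k (formal limit).
prodInf : FPS
prodInf k = prodUpTo k k

-- n(n-1)/2 for n ∈ ℤ (always a natural number)
tri : ℤ → ℕ
tri n = ∣ n ℤ.* (n ℤ.- ℤ.+ 1) ∣ ℕ./ 2

theta : ℤ → ℕ → ℕ
theta n v = if v ≡ᵇ tri n then 1 else 0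

-- Coefficient of t^n q^u in prodInf(q) · Σ_n q^{n(n-1)/2} t^n.
rhsCoeff : ℤ → ℕ → ℕ
rhsCoeff n u = sumTo (suc u) (λ j → prodInf j ℕ.* theta n (u ∸ j))

{-# OPTIONS --safe #-}
-- A configuration is read column by column as a function ℤ → Maybe (Fin 3).  Between two
-- consecutive occupied columns the edges leave a single admissible vertex, so a run of
-- occupied columns is fixed by its first vertex.  An element of Ĉ is the tail of T up to some
-- column followed by a finite word; after discarding the part that merely continues T, the
-- word is a list of blocks, each an empty column followed by either nothing or a run of r+1
-- occupied columns with one of 3 starting vertices.  Deleting a point p from a Dirac set
-- lowers its charge by 1 and its energy by p; inserting the empty columns one at a time shows the
-- energy is n(n-1)/2 plus Σ i·(size of block i).  Lists of K blocks of weight k are counted by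
-- the coefficient of q^k in ∏_{m ≤ K} (1 + 3q^m + 3q^{2m} + ⋯) = ∏_{m ≤ K} (1 + 2q^m)/(1 - q^m),
-- and K = k blocks suffice because a nonempty block beyond position k weighs more than k.
module Submission where

open import Defs
open import Data.Bool using (Bool; true; false; not; if_then_else_)
open import Data.Nat as ℕ using (ℕ; zero; suc; _≤_; _<_; z≤n; s≤s; _∸_; _/_; _≡ᵇ_)
open import Data.Nat.Divisibility using (_∣_; divides; _∣?_; _∣0; ∣-refl; ∣⇒≤; ∣m∣n⇒∣m+n; ∣m+n∣m⇒∣n)
import Data.Nat.Properties as ℕP
open import Data.Integer as ℤ using (ℤ; +_; -[1+_]; ∣_∣)
import Data.Integer.Properties as ℤP
open import Data.Fin using (Fin; zero; suc)
import Data.Fin.Properties as FinP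
open import Data.Maybe using (Maybe; just; nothing; is-just)
open import Data.Product using (Σ; _×_; _,_; proj₁; proj₂)
open import Data.List using (List; []; _∷_; _++_; _∷ʳ_; length; replicate; map; cartesianProductWith; initLast; _∷ʳ′_)
open import Data.List.Properties using (++-identityʳ; ++-assoc; length-replicate; length-++; length-map; ∷ʳ-injective)
open import Data.List.Membership.Propositional using (_∈_; lose)
open import Data.List.Membership.Propositional.Properties using (∈-map⁺; ∈-++⁻; ∈-++⁺ˡ; ∈-++⁺ʳ; ∈-cartesianProductWith⁺; ∈-cartesianProductWith⁻)
open import Data.List.Relation.Unary.Any using (Any; here; there)
import Data.List.Relation.Unary.All as All
import Data.List.Relation.Unary.All.Properties as All
import Data.List.Relation.Unary.AllPairs.Properties as AllPairs
open import Data.List.Relation.Unary.All using (All; []; _∷_)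
open import Data.List.Relation.Unary.AllPairs using (AllPairs; []; _∷_)
open import Data.List.Relation.Unary.Unique.Propositional using (Unique)
open import Data.List.Relation.Unary.Unique.Propositional.Properties using (++⁺; cartesianProductWith⁺)
open import Data.Sum using (inj₁; inj₂)
open import Data.Nat.GeneralisedArithmetic using (iterate)
open import Function using (_∘′_)
open import Data.Unit using (⊤; tt)
open import Data.Empty using (⊥; ⊥-elim)
open import Relation.Nullary using (¬_; does; yes; no; Dec)
open import Relation.Nullary.Decidable using (dec-true; dec-false)
open import Relation.Binary.PropositionalEquality hiding ([_])
open import Relation.Binary.Definitions using (tri<; tri≈; tri>)
open import Data.Nat.DivMod using (m*n/n≡m)
open import Data.Nat.Tactic.RingSolver as ℕSolver using ()
open import Data.Integer.Tactic.RingSolver as ℤSolver using ()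
open import Algebra.Properties.AbelianGroup ℤP.+-0-abelianGroup using (∙-cancelʳ; //-rightDividesˡ; //-rightDividesʳ)

State : Set
State = Maybe (Fin 3)

-- The edges x_i–x_{i+1}, x_i–y_{i+1}, y_i–y_{i+1}, ... leave exactly one
-- admissible vertex in column i+1 after a vertex in column i.
next : Fin 3 → Fin 3
next zero             = suc (suc zero)
next (suc zero)       = zero
next (suc (suc zero)) = suc zero

Compatible : State → State → Set
Compatible (just a) (just b) = b ≡ next a
Compatible _        _        = ⊤

Compatible-nothing : ∀ s → Compatible s nothing
Compatible-nothing nothing  = tt
Compatible-nothing (just _) = tt

occupies : State → Fin 3 → Bool
occupies nothing  a = false
occupies (just b) a = does (b FinP.≟ a)

occupies-sound : ∀ s a → occupies s a ≡ true → s ≡ just a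
occupies-sound (just b) a e with b FinP.≟ a
... | yes refl = refl

occupies-refl : ∀ a → occupies (just a) a ≡ true
occupies-refl a with a FinP.≟ a
... | yes _  = refl
... | no a≢a = ⊥-elim (a≢a refl)

occupies-injective : ∀ s t → (∀ a → occupies s a ≡ occupies t a) → s ≡ t
occupies-injective nothing  nothing  _ = refl
occupies-injective (just a) t        h = sym (occupies-sound t a (trans (sym (h a)) (occupies-refl a)))
occupies-injective nothing  (just b) h with trans (h b) (occupies-refl b)
... | ()

toVSet : (ℤ → State) → VSet
toVSet σ i = occupies (σ i)

toVSet-injective : ∀ σ σ' → SameSet (toVSet σ) (toVSet σ') → ∀ i → σ i ≡ σ' i
toVSet-injective σ σ' h i = occupies-injective (σ i) (σ' i) (h i)

Ω-toVSet : ∀ σ i → Ω (toVSet σ) i ≡ is-just (σ i)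
Ω-toVSet σ i with σ i
... | nothing               = refl
... | just zero             = refl
... | just (suc zero)       = refl
... | just (suc (suc zero)) = refl

toVSet-isConfiguration : ∀ σ → (∀ i → Compatible (σ i) (σ (ℤ.suc i))) → IsConfiguration (toVSet σ)
toVSet-isConfiguration σ compat i a j b e (χia , χjb) =
  edge-forbidden e (occupies-sound _ _ χia) (occupies-sound _ _ χjb)
  where
  edge-forbidden : ∀ {i a j b} → Edge (i , a) (j , b) → σ i ≡ just a → σ j ≡ just b → ⊥
  edge-forbidden (xy i)  p q with trans (sym p) q
  ... | ()
  edge-forbidden (yz i)  p q with trans (sym p) q
  ... | ()
  edge-forbidden (zx i)  p q with trans (sym p) q
  ... | ()
  edge-forbidden (xx' i) p q with subst₂ Compatible p q (compat i)
  ... | ()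
  edge-forbidden (yy' i) p q with subst₂ Compatible p q (compat i)
  ... | ()
  edge-forbidden (zz' i) p q with subst₂ Compatible p q (compat i)
  ... | ()
  edge-forbidden (xy' i) p q with subst₂ Compatible p q (compat i)
  ... | ()
  edge-forbidden (yz' i) p q with subst₂ Compatible p q (compat i)
  ... | ()
  edge-forbidden (zx' i) p q with subst₂ Compatible p q (compat i)
  ... | ()

stateFrom : Bool → Bool → Bool → State
stateFrom x y z = if x then just X else (if y then just Y else (if z then just Z else nothing))

stateOf : VSet → ℤ → State
stateOf χ i = stateFrom (χ i X) (χ i Y) (χ i Z)

stateOf-cong : ∀ χ χ' i → (∀ a → χ i a ≡ χ' i a) → stateOf χ i ≡ stateOf χ' i
stateOf-cong χ χ' i h rewrite h X | h Y | h Z = refl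

Ω-stateOf : ∀ χ i → Ω χ i ≡ is-just (stateOf χ i)
Ω-stateOf χ i with χ i X | χ i Y | χ i Z
... | true  | _     | _     = refl
... | false | true  | _     = refl
... | false | false | true  = refl
... | false | false | false = refl

module _ (χ : VSet) (config : IsConfiguration χ) where

  toVSet-stateOf : ∀ i a → χ i a ≡ toVSet (stateOf χ) i a
  toVSet-stateOf i a with χ i X in ex | χ i Y in ey | χ i Z in ez
  ... | true  | true  | _     = ⊥-elim (config i X i Y (xy i) (ex , ey))
  ... | true  | _     | true  = ⊥-elim (config i Z i X (zx i) (ez , ex))
  ... | _     | true  | true  = ⊥-elim (config i Y i Z (yz i) (ey , ez))
  toVSet-stateOf i zero             | true | false | false = ex
  toVSet-stateOf i (suc zero)       | true | false | false = ey
  toVSet-stateOf i (suc (suc zero)) | true | false | false = ez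
  toVSet-stateOf i zero             | false | true | false = ex
  toVSet-stateOf i (suc zero)       | false | true | false = ey
  toVSet-stateOf i (suc (suc zero)) | false | true | false = ez
  toVSet-stateOf i zero             | false | false | true = ex
  toVSet-stateOf i (suc zero)       | false | false | true = ey
  toVSet-stateOf i (suc (suc zero)) | false | false | true = ez
  toVSet-stateOf i zero             | false | false | false = ex
  toVSet-stateOf i (suc zero)       | false | false | false = ey
  toVSet-stateOf i (suc (suc zero)) | false | false | false = ez

  stateOf-occupied : ∀ i a → stateOf χ i ≡ just a → χ i a ≡ true
  stateOf-occupied i a e = trans (toVSet-stateOf i a) (subst (λ s → occupies s a ≡ true) (sym e) (occupies-refl a))

  no-edge : ∀ {i a j b} → Edge (i , a) (j , b) → stateOf χ i ≡ just a → stateOf χ j ≡ just b → ⊥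
  no-edge e p q = config _ _ _ _ e (stateOf-occupied _ _ p , stateOf-occupied _ _ q)

  stateOf-compatible : ∀ i → Compatible (stateOf χ i) (stateOf χ (ℤ.suc i))
  stateOf-compatible i with stateOf χ i in p | stateOf χ (ℤ.suc i) in q
  ... | nothing               | _                     = tt
  ... | just _                | nothing               = tt
  ... | just zero             | just zero             = ⊥-elim (no-edge (xx' i) p q)
  ... | just zero             | just (suc zero)       = ⊥-elim (no-edge (xy' i) p q)
  ... | just zero             | just (suc (suc zero)) = refl
  ... | just (suc zero)       | just zero             = refl
  ... | just (suc zero)       | just (suc zero)       = ⊥-elim (no-edge (yy' i) p q)
  ... | just (suc zero)       | just (suc (suc zero)) = ⊥-elim (no-edge (yz' i) p q)
  ... | just (suc (suc zero)) | just zero             = ⊥-elim (no-edge (zx' i) p q)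
  ... | just (suc (suc zero)) | just (suc zero)       = refl
  ... | just (suc (suc zero)) | just (suc (suc zero)) = ⊥-elim (no-edge (zz' i) p q)

sumTo-cong : ∀ N {f g : ℕ → ℕ} → (∀ k → k < N → f k ≡ g k) → sumTo N f ≡ sumTo N g
sumTo-cong zero    h = refl
sumTo-cong (suc N) h = cong₂ ℕ._+_ (sumTo-cong N (λ k k<N → h k (ℕP.m<n⇒m<1+n k<N))) (h N ℕP.≤-refl)

sumTo-zero : ∀ N {f : ℕ → ℕ} → (∀ k → k < N → f k ≡ 0) → sumTo N f ≡ 0
sumTo-zero zero    h = refl
sumTo-zero (suc N) h = cong₂ ℕ._+_ (sumTo-zero N (λ k k<N → h k (ℕP.m<n⇒m<1+n k<N))) (h N ℕP.≤-refl)

sumTo-+ : ∀ m n (f : ℕ → ℕ) → sumTo (m ℕ.+ n) f ≡ sumTo m f ℕ.+ sumTo n (λ k → f (m ℕ.+ k))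
sumTo-+ m zero    f rewrite ℕP.+-identityʳ m = sym (ℕP.+-identityʳ _)
sumTo-+ m (suc n) f rewrite ℕP.+-suc m n | sumTo-+ m n f = ℕP.+-assoc (sumTo m f) _ (f (m ℕ.+ n))

sumTo-stable : ∀ {M} N (f : ℕ → ℕ) → (∀ k → M ≤ k → f k ≡ 0) → M ≤ N → sumTo N f ≡ sumTo M f
sumTo-stable {M} N f h M≤N = begin
  sumTo N f                                            ≡⟨ cong (λ n → sumTo n f) (sym (ℕP.m+[n∸m]≡n M≤N)) ⟩
  sumTo (M ℕ.+ (N ∸ M)) f                              ≡⟨ sumTo-+ M (N ∸ M) f ⟩
  sumTo M f ℕ.+ sumTo (N ∸ M) (λ k → f (M ℕ.+ k))      ≡⟨ cong (sumTo M f ℕ.+_) (sumTo-zero (N ∸ M) (λ k _ → h (M ℕ.+ k) (ℕP.m≤m+n M k))) ⟩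
  sumTo M f ℕ.+ 0                                      ≡⟨ ℕP.+-identityʳ _ ⟩
  sumTo M f                                            ∎
  where open ≡-Reasoning

sumTo-differAt : ∀ N k {f g : ℕ → ℕ} d → k < N → (∀ j → j < N → j ≢ k → f j ≡ g j) → f k ≡ g k ℕ.+ d →
                 sumTo N f ≡ sumTo N g ℕ.+ d
sumTo-differAt (suc N) k {f} {g} d k<1+N h fk with k ℕP.≟ N
... | yes refl = begin
  sumTo N f ℕ.+ f N          ≡⟨ cong₂ ℕ._+_ (sumTo-cong N (λ j j<N → h j (ℕP.m<n⇒m<1+n j<N) (ℕP.<⇒≢ j<N))) fk ⟩
  sumTo N g ℕ.+ (g N ℕ.+ d)  ≡⟨ ℕP.+-assoc (sumTo N g) (g N) d ⟨
  sumTo N g ℕ.+ g N ℕ.+ d    ∎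
  where open ≡-Reasoning
... | no k≢N = begin
  sumTo N f ℕ.+ f N          ≡⟨ cong₂ ℕ._+_ (sumTo-differAt N k d k<N (λ j j<N → h j (ℕP.m<n⇒m<1+n j<N)) fk)
                                            (h N ℕP.≤-refl (k≢N ∘′ sym)) ⟩
  sumTo N g ℕ.+ d ℕ.+ g N    ≡⟨ ℕP.+-assoc (sumTo N g) d (g N) ⟩
  sumTo N g ℕ.+ (d ℕ.+ g N)  ≡⟨ cong (sumTo N g ℕ.+_) (ℕP.+-comm d (g N)) ⟩
  sumTo N g ℕ.+ (g N ℕ.+ d)  ≡⟨ ℕP.+-assoc (sumTo N g) (g N) d ⟨
  sumTo N g ℕ.+ g N ℕ.+ d    ∎
  where
  open ≡-Reasoning
  k<N = ℕP.≤∧≢⇒< (ℕP.≤-pred k<1+N) k≢N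

sumTo-single : ∀ N k {f : ℕ → ℕ} → k < N → (∀ j → j < N → j ≢ k → f j ≡ 0) → sumTo N f ≡ f k
sumTo-single N k {f} k<N h =
  trans (sumTo-differAt N k {g = λ _ → 0} (f k) k<N h refl) (cong (ℕ._+ f k) (sumTo-zero N (λ _ _ → refl)))

concatUpTo : {A : Set} → ℕ → (ℕ → List A) → List A
concatUpTo zero    f = []
concatUpTo (suc N) f = concatUpTo N f ++ f N

module _ {A : Set} where

  length-concatUpTo : ∀ N (f : ℕ → List A) → length (concatUpTo N f) ≡ sumTo N (λ j → length (f j))
  length-concatUpTo zero    f = refl
  length-concatUpTo (suc N) f = trans (length-++ (concatUpTo N f)) (cong (ℕ._+ length (f N)) (length-concatUpTo N f))

  ∈-concatUpTo⁻ : ∀ N (f : ℕ → List A) {x} → x ∈ concatUpTo N f → Σ ℕ λ j → j < N × x ∈ f j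
  ∈-concatUpTo⁻ (suc N) f x∈ with ∈-++⁻ (concatUpTo N f) x∈
  ... | inj₁ x∈ˡ with j , j<N , x∈fj ← ∈-concatUpTo⁻ N f x∈ˡ = j , ℕP.m<n⇒m<1+n j<N , x∈fj
  ... | inj₂ x∈fN = N , ℕP.≤-refl , x∈fN

  ∈-concatUpTo⁺ : ∀ N (f : ℕ → List A) {x} j → j < N → x ∈ f j → x ∈ concatUpTo N f
  ∈-concatUpTo⁺ (suc N) f j j<1+N x∈fj with j ℕP.≟ N
  ... | yes refl = ∈-++⁺ʳ (concatUpTo N f) x∈fj
  ... | no  j≢N  = ∈-++⁺ˡ (∈-concatUpTo⁺ N f j (ℕP.≤∧≢⇒< (ℕP.≤-pred j<1+N) j≢N) x∈fj)

  concatUpTo-unique : ∀ N (f : ℕ → List A) → (∀ j → Unique (f j)) → (∀ {i j x} → x ∈ f i → x ∈ f j → i ≡ j) →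
                      Unique (concatUpTo N f)
  concatUpTo-unique zero    f unique disjoint = []
  concatUpTo-unique (suc N) f unique disjoint =
    ++⁺ (concatUpTo-unique N f unique disjoint) (unique N) λ (x∈ˡ , x∈fN) →
      let j , j<N , x∈fj = ∈-concatUpTo⁻ N f x∈ˡ in ℕP.<-irrefl (disjoint x∈fj x∈fN) j<N

length-cartesianProductWith : {A B C : Set} (f : A → B → C) (xs : List A) (ys : List B) →
                              length (cartesianProductWith f xs ys) ≡ length xs ℕ.* length ys
length-cartesianProductWith f []       ys = refl
length-cartesianProductWith f (x ∷ xs) ys =
  trans (length-++ (map (f x) ys)) (cong₂ ℕ._+_ (length-map (f x) ys) (length-cartesianProductWith f xs ys))

AllPairs-mapWith : {A : Set} {P : A → Set} {R S : A → A → Set} {xs : List A} →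
                   (∀ {x y} → P x → P y → R x y → S x y) → All P xs → AllPairs R xs → AllPairs S xs
AllPairs-mapWith f []         []           = []
AllPairs-mapWith f (px ∷ pxs) (rx ∷ rxs) = go pxs rx ∷ AllPairs-mapWith f pxs rxs
  where
  go : ∀ {ys} → All _ ys → All _ ys → All _ ys
  go []         []         = []
  go (py ∷ pys) (r ∷ rs)   = f px py r ∷ go pys rs

triangle : ℕ → ℕ
triangle m = sumTo m (λ k → k)

triangle-double : ∀ m → triangle (suc m) ℕ.* 2 ≡ suc m ℕ.* m
triangle-double zero    = refl
triangle-double (suc m) = begin
  (triangle (suc m) ℕ.+ suc m) ℕ.* 2    ≡⟨ ℕP.*-distribʳ-+ 2 (triangle (suc m)) (suc m) ⟩
  triangle (suc m) ℕ.* 2 ℕ.+ suc m ℕ.* 2 ≡⟨ cong (ℕ._+ suc m ℕ.* 2) (triangle-double m) ⟩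
  suc m ℕ.* m ℕ.+ suc m ℕ.* 2           ≡⟨ expand m ⟩
  suc (suc m) ℕ.* suc m                 ∎
  where
  open ≡-Reasoning
  expand : ∀ m → suc m ℕ.* m ℕ.+ suc m ℕ.* 2 ≡ suc (suc m) ℕ.* suc m
  expand = ℕSolver.solve-∀

triangle-half : ∀ m → (suc m ℕ.* m) ℕ./ 2 ≡ triangle (suc m)
triangle-half m = trans (cong (ℕ._/ 2) (sym (triangle-double m))) (m*n/n≡m (triangle (suc m)) 2)

tri-pos : ∀ m → tri (+ m) ≡ triangle m
tri-pos zero    = refl
tri-pos (suc m) = trans (cong (ℕ._/ 2) (ℤP.abs-* (+ suc m) (+ m))) (triangle-half m)

tri-neg : ∀ m → tri -[1+ m ] ≡ triangle (suc (suc m))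
tri-neg m = begin
  tri -[1+ m ]                          ≡⟨ cong (ℕ._/ 2) (ℤP.abs-* -[1+ m ] (-[1+ m ] ℤ.- + 1)) ⟩
  (suc m ℕ.* suc (suc (m ℕ.+ 0))) ℕ./ 2 ≡⟨ cong (λ k → (suc m ℕ.* suc (suc k)) ℕ./ 2) (ℕP.+-identityʳ m) ⟩
  (suc m ℕ.* suc (suc m)) ℕ./ 2      ≡⟨ cong (ℕ._/ 2) (ℕP.*-comm (suc m) (suc (suc m))) ⟩
  (suc (suc m) ℕ.* suc m) ℕ./ 2      ≡⟨ triangle-half (suc m) ⟩
  triangle (suc (suc m))             ∎
  where open ≡-Reasoning

tri-suc : ∀ c → + tri (ℤ.suc c) ≡ + tri c ℤ.+ c
tri-suc (+ m) rewrite tri-pos m | tri-pos (suc m) = ℤP.pos-+ (triangle m) m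
tri-suc -[1+ zero ] = refl
tri-suc -[1+ suc m ] rewrite tri-neg m | tri-neg (suc m) | ℤP.pos-+ (triangle (suc (suc m))) (suc (suc m)) =
  sym (//-rightDividesʳ (+ suc (suc m)) (+ triangle (suc (suc m))))

electrons positrons electronEnergy positronEnergy : (ℤ → Bool) → ℕ → ℕ
electrons      S N = sumTo N (λ k → [ S (+ k) ])
positrons      S N = sumTo N (λ k → [ not (S -[1+ k ]) ])
electronEnergy S N = sumTo N (λ k → [ S (+ k) ] ℕ.* k)
positronEnergy S N = sumTo N (λ k → [ not (S -[1+ k ]) ] ℕ.* suc k)

module _ {S S' : ℤ → Bool} (same : ∀ i → S i ≡ S' i) where

  chargeN-cong : ∀ N → chargeN S N ≡ chargeN S' N
  chargeN-cong N = cong₂ (λ e p → + e ℤ.- + p)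
    (sumTo-cong N (λ k _ → cong [_] (same (+ k))))
    (sumTo-cong N (λ k _ → cong (λ b → [ not b ]) (same -[1+ k ])))

  energyN-cong : ∀ N → energyN S N ≡ energyN S' N
  energyN-cong N = cong₂ ℕ._+_
    (sumTo-cong N (λ k _ → cong (λ b → [ b ] ℕ.* k) (same (+ k))))
    (sumTo-cong N (λ k _ → cong (λ b → [ not b ] ℕ.* suc k) (same -[1+ k ])))

  DiracBound-cong : ∀ N → DiracBound S' N → DiracBound S N
  DiracBound-cong N (above , below) = (λ k k≥N → trans (same (+ k)) (above k k≥N)) ,
                                      (λ k k≥N → trans (same -[1+ k ]) (below k k≥N))

module _ (S : ℤ → Bool) {M N} (bound : DiracBound S M) (M≤N : M ≤ N) where
  private
    above = proj₁ bound
    below = proj₂ bound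

  chargeN-stable : chargeN S N ≡ chargeN S M
  chargeN-stable = cong₂ (λ e p → + e ℤ.- + p)
    (sumTo-stable N _ (λ k k≥M → cong [_] (above k k≥M)) M≤N)
    (sumTo-stable N _ (λ k k≥M → cong (λ b → [ not b ]) (below k k≥M)) M≤N)

  energyN-stable : energyN S N ≡ energyN S M
  energyN-stable = cong₂ ℕ._+_
    (sumTo-stable N _ (λ k k≥M → cong (λ b → [ b ] ℕ.* k) (above k k≥M)) M≤N)
    (sumTo-stable N _ (λ k k≥M → cong (λ b → [ not b ] ℕ.* suc k) (below k k≥M)) M≤N)

record Removes (S S' : ℤ → Bool) (p : ℤ) : Set where
  field
    in-S       : S p ≡ true
    not-in-S'  : S' p ≡ false
    same-else  : ∀ i → i ≢ p → S i ≡ S' i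

ChargeEnergyStep : (ℤ → Bool) → (ℤ → Bool) → ℕ → ℤ → Set
ChargeEnergyStep S S' N p = chargeN S N ≡ chargeN S' N ℤ.+ ℤ.1ℤ × + energyN S N ≡ + energyN S' N ℤ.+ p

module _ {S S' : ℤ → Bool} {p} (removes : Removes S S' p) (N : ℕ) where
  open Removes removes

  private
    away-from-p : ∀ i → i ≢ p → ∀ (f : Bool → ℕ) → f (S i) ≡ f (S' i)
    away-from-p i i≢p f = cong f (same-else i i≢p)

  remove-electron : ∀ k → p ≡ + k → k < N → ChargeEnergyStep S S' N p
  remove-electron k refl k<N = charge , energy
    where
    others : ∀ (f : Bool → ℕ) j → j ≢ k → f (S (+ j)) ≡ f (S' (+ j))
    others f j j≢k = away-from-p (+ j) (j≢k ∘′ ℤP.+-injective) f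
    count≡ : electrons S N ≡ electrons S' N ℕ.+ 1
    count≡ = sumTo-differAt N k 1 k<N (λ j _ → others [_] j) (subst₂ (λ b b' → [ b ] ≡ [ b' ] ℕ.+ 1) (sym in-S) (sym not-in-S') refl)
    energy≡ : electronEnergy S N ≡ electronEnergy S' N ℕ.+ k
    energy≡ = sumTo-differAt N k k k<N (λ j _ → others (λ b → [ b ] ℕ.* j) j)
               (subst₂ (λ b b' → [ b ] ℕ.* k ≡ [ b' ] ℕ.* k ℕ.+ k) (sym in-S) (sym not-in-S') (ℕP.+-identityʳ k))
    positrons-same : ∀ (f : ℕ → Bool → ℕ) → sumTo N (λ j → f j (S -[1+ j ])) ≡ sumTo N (λ j → f j (S' -[1+ j ]))
    positrons-same f = sumTo-cong N (λ j _ → away-from-p -[1+ j ] (λ ()) (f j))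
    charge : chargeN S N ≡ chargeN S' N ℤ.+ ℤ.1ℤ
    charge = begin
      + electrons S N ℤ.- + positrons S N                 ≡⟨ cong₂ (λ e q → + e ℤ.- + q) count≡ (positrons-same (λ _ b → [ not b ])) ⟩
      + (electrons S' N ℕ.+ 1) ℤ.- + positrons S' N       ≡⟨ cong (ℤ._- + positrons S' N) (ℤP.pos-+ (electrons S' N) 1) ⟩
      + electrons S' N ℤ.+ ℤ.1ℤ ℤ.- + positrons S' N      ≡⟨ shift (+ electrons S' N) (+ positrons S' N) ⟩
      chargeN S' N ℤ.+ ℤ.1ℤ                               ∎
      where
      open ≡-Reasoning
      shift : ∀ e q → e ℤ.+ ℤ.1ℤ ℤ.- q ≡ e ℤ.- q ℤ.+ ℤ.1ℤ
      shift = ℤSolver.solve-∀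
    energy : + energyN S N ≡ + energyN S' N ℤ.+ + k
    energy = begin
      + (electronEnergy S N ℕ.+ positronEnergy S N)          ≡⟨ cong₂ (λ e q → + (e ℕ.+ q)) energy≡ (positrons-same (λ j b → [ not b ] ℕ.* suc j)) ⟩
      + (electronEnergy S' N ℕ.+ k ℕ.+ positronEnergy S' N)  ≡⟨ cong +_ (swap (electronEnergy S' N) k _) ⟩
      + (energyN S' N ℕ.+ k)                                 ≡⟨ ℤP.pos-+ (energyN S' N) k ⟩
      + energyN S' N ℤ.+ + k                                 ∎
      where
      open ≡-Reasoning
      swap : ∀ e k q → e ℕ.+ k ℕ.+ q ≡ e ℕ.+ q ℕ.+ k
      swap = ℕSolver.solve-∀

  remove-positron : ∀ k → p ≡ -[1+ k ] → k < N → ChargeEnergyStep S S' N p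
  remove-positron k refl k<N = charge , energy
    where
    others : ∀ (f : Bool → ℕ) j → j ≢ k → f (S' -[1+ j ]) ≡ f (S -[1+ j ])
    others f j j≢k = sym (away-from-p -[1+ j ] (λ { refl → j≢k refl }) f)
    count≡ : positrons S' N ≡ positrons S N ℕ.+ 1
    count≡ = sumTo-differAt N k 1 k<N (λ j _ → others (λ b → [ not b ]) j)
              (subst₂ (λ b b' → [ not b ] ≡ [ not b' ] ℕ.+ 1) (sym not-in-S') (sym in-S) refl)
    energy≡ : positronEnergy S' N ≡ positronEnergy S N ℕ.+ suc k
    energy≡ = sumTo-differAt N k (suc k) k<N (λ j _ → others (λ b → [ not b ] ℕ.* suc j) j)
               (subst₂ (λ b b' → [ not b ] ℕ.* suc k ≡ [ not b' ] ℕ.* suc k ℕ.+ suc k) (sym not-in-S') (sym in-S)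
                 (ℕP.+-identityʳ (suc k)))
    electrons-same : ∀ (f : ℕ → Bool → ℕ) → sumTo N (λ j → f j (S' (+ j))) ≡ sumTo N (λ j → f j (S (+ j)))
    electrons-same f = sym (sumTo-cong N (λ j _ → away-from-p (+ j) (λ ()) (f j)))
    charge : chargeN S N ≡ chargeN S' N ℤ.+ ℤ.1ℤ
    charge = begin
      + electrons S N ℤ.- + positrons S N                       ≡⟨ shift (+ electrons S N) (+ positrons S N) ⟩
      + electrons S N ℤ.- (+ positrons S N ℤ.+ ℤ.1ℤ) ℤ.+ ℤ.1ℤ   ≡⟨ cong₂ (λ e q → + e ℤ.- q ℤ.+ ℤ.1ℤ) (sym (electrons-same (λ _ → [_])))
                                                                       (trans (sym (ℤP.pos-+ (positrons S N) 1)) (cong +_ (sym count≡))) ⟩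
      chargeN S' N ℤ.+ ℤ.1ℤ                                     ∎
      where
      open ≡-Reasoning
      shift : ∀ e q → e ℤ.- q ≡ e ℤ.- (q ℤ.+ ℤ.1ℤ) ℤ.+ ℤ.1ℤ
      shift = ℤSolver.solve-∀
    energy : + energyN S N ≡ + energyN S' N ℤ.+ -[1+ k ]
    energy = begin
      + energyN S N                                                    ≡⟨ //-rightDividesʳ (+ suc k) (+ energyN S N) ⟨
      + energyN S N ℤ.+ + suc k ℤ.+ -[1+ k ]                           ≡⟨ cong (ℤ._+ -[1+ k ]) (ℤP.pos-+ (energyN S N) (suc k)) ⟨
      + (electronEnergy S N ℕ.+ positronEnergy S N ℕ.+ suc k) ℤ.+ -[1+ k ] ≡⟨ cong (λ x → + x ℤ.+ -[1+ k ]) (ℕP.+-assoc (electronEnergy S N) _ (suc k)) ⟩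
      + (electronEnergy S N ℕ.+ (positronEnergy S N ℕ.+ suc k)) ℤ.+ -[1+ k ] ≡⟨ cong₂ (λ e q → + (e ℕ.+ q) ℤ.+ -[1+ k ])
                                                                                 (electrons-same (λ j b → [ b ] ℕ.* j)) energy≡ ⟨
      + energyN S' N ℤ.+ -[1+ k ]                                      ∎
      where open ≡-Reasoning

-- Deleting p < 0 creates a positron of energy -p, so in both cases the energy drops by p.
removal-chargeN-energyN : ∀ {S S' p} N → ℤ.- (+ N) ℤ.≤ p → p ℤ.< + N → Removes S S' p → ChargeEnergyStep S S' N p
removal-chargeN-energyN {p = + k}      N _   (ℤ.+<+ k<N) removes = remove-electron removes N k refl k<N
removal-chargeN-energyN {p = -[1+ k ]} N -N≤p _           removes = remove-positron removes N k refl (neg-bound N -N≤p)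
  where
  neg-bound : ∀ N → ℤ.- (+ N) ℤ.≤ -[1+ k ] → k < N
  neg-bound (suc N) (ℤ.-≤- k≤N) = s≤s k≤N

ChainFrom : State → List State → Set
ChainFrom s []      = ⊤
ChainFrom s (t ∷ w) = Compatible s t × ChainFrom t w

Chain : List State → Set
Chain []      = ⊤
Chain (t ∷ w) = ChainFrom t w

head : List State → State
head []      = nothing
head (t ∷ _) = t

ChainFrom-head : ∀ s w → ChainFrom s w → Compatible s (head w)
ChainFrom-head s []      _       = Compatible-nothing s
ChainFrom-head s (t ∷ w) (c , _) = c

ChainFrom⇒Chain : ∀ s w → ChainFrom s w → Chain w
ChainFrom⇒Chain s []      _       = tt
ChainFrom⇒Chain s (t ∷ w) (_ , c) = c

occupancy : List State → ℕ
occupancy []           = 0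
occupancy (nothing ∷ w) = occupancy w
occupancy (just _ ∷ w)  = suc (occupancy w)

-- h counts the empty columns to the left; every occupied column then adds
-- the number of empty columns preceding it.
inversions : ℕ → List State → ℕ
inversions h []            = 0
inversions h (nothing ∷ w) = inversions (suc h) w
inversions h (just _ ∷ w)  = h ℕ.+ inversions h w

inversions-suc : ∀ h w → inversions (suc h) w ≡ inversions h w ℕ.+ occupancy w
inversions-suc h []            = refl
inversions-suc h (nothing ∷ w) = inversions-suc (suc h) w
inversions-suc h (just _ ∷ w)  rewrite inversions-suc h w =
  trans (cong suc (sym (ℕP.+-assoc h _ (occupancy w)))) (sym (ℕP.+-suc _ (occupancy w)))

holes : List State → ℕ
holes []            = 0
holes (nothing ∷ w) = suc (holes w)
holes (just _ ∷ w)  = holes w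

Block : Set
Block = Maybe (ℕ × Fin 3)

size : Block → ℕ
size nothing        = 0
size (just (r , _)) = suc r

runFrom : ℕ → Fin 3 → List State
runFrom zero    c = just c ∷ []
runFrom (suc r) c = just c ∷ runFrom r (next c)

run : Block → List State
run nothing        = []
run (just (r , c)) = runFrom r c

-- Each block is preceded by an empty column; block i (from 1) then costs i per column.
encode : List Block → List State
encode []       = []
encode (b ∷ cs) = nothing ∷ (run b ++ encode cs)

weight : ℕ → List Block → ℕ
weight m []       = 0
weight m (b ∷ cs) = m ℕ.* size b ℕ.+ weight (suc m) cs

totalSize : List Block → ℕ
totalSize []       = 0
totalSize (b ∷ cs) = size b ℕ.+ totalSize cs

occupancy-run : ∀ b w → occupancy (run b ++ w) ≡ size b ℕ.+ occupancy w
occupancy-run nothing        w = refl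
occupancy-run (just (r , c)) w = go r c
  where
  go : ∀ r c → occupancy (runFrom r c ++ w) ≡ suc r ℕ.+ occupancy w
  go zero    c = refl
  go (suc r) c = cong suc (go r (next c))

occupancy-encode : ∀ cs → occupancy (encode cs) ≡ totalSize cs
occupancy-encode []       = refl
occupancy-encode (b ∷ cs) = trans (occupancy-run b (encode cs)) (cong (size b ℕ.+_) (occupancy-encode cs))

inversions-run : ∀ h b w → inversions h (run b ++ w) ≡ h ℕ.* size b ℕ.+ inversions h w
inversions-run h nothing        w = cong (ℕ._+ inversions h w) (sym (ℕP.*-zeroʳ h))
inversions-run h (just (r , c)) w = go r c
  where
  go : ∀ r c → inversions h (runFrom r c ++ w) ≡ h ℕ.* suc r ℕ.+ inversions h w
  go zero    c = cong (ℕ._+ inversions h w) (sym (ℕP.*-identityʳ h))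
  go (suc r) c rewrite go r (next c) | ℕP.*-suc h (suc r) = sym (ℕP.+-assoc h (h ℕ.* suc r) _)

inversions-encode : ∀ h cs → inversions h (encode cs) ≡ weight (suc h) cs
inversions-encode h []       = refl
inversions-encode h (b ∷ cs) =
  trans (inversions-run (suc h) b (encode cs)) (cong (suc h ℕ.* size b ℕ.+_) (inversions-encode (suc h) cs))

holes-encode : ∀ cs → holes (encode cs) ≡ length cs
holes-encode []       = refl
holes-encode (b ∷ cs) = cong suc (trans (holes-run b) (holes-encode cs))
  where
  holes-run : ∀ b → holes (run b ++ encode cs) ≡ holes (encode cs)
  holes-run nothing        = refl
  holes-run (just (r , c)) = go r c
    where
    go : ∀ r c → holes (runFrom r c ++ encode cs) ≡ holes (encode cs)
    go zero    c = refl
    go (suc r) c = go r (next c)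

head-encode : ∀ cs → head (encode cs) ≡ nothing
head-encode []      = refl
head-encode (_ ∷ _) = refl

encode-chain : ∀ p cs → ChainFrom p (encode cs)
encode-chain p []                   = tt
encode-chain p (nothing ∷ cs)       = Compatible-nothing p , encode-chain nothing cs
encode-chain p (just (r , c) ∷ cs) = Compatible-nothing p , runFrom-chain r c nothing tt
  where
  runFrom-chain : ∀ r c p → Compatible p (just c) → ChainFrom p (runFrom r c ++ encode cs)
  runFrom-chain zero    c p pc = pc , encode-chain (just c) cs
  runFrom-chain (suc r) c p pc = pc , runFrom-chain r (next c) (just c) refl

lastOf : Block → State
lastOf nothing        = nothing
lastOf (just (r , c)) = just (iterate next c r)

iterate-suc : ∀ r c → iterate next c (suc r) ≡ next (iterate next c r)
iterate-suc zero    c = refl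
iterate-suc (suc r) c = iterate-suc r (next c)

runFrom-suc : ∀ r c → runFrom (suc r) c ≡ runFrom r c ++ just (iterate next c (suc r)) ∷ []
runFrom-suc zero    c = refl
runFrom-suc (suc r) c = cong (just c ∷_) (runFrom-suc r (next c))

parseFrom : Block → List State → List Block
parseFrom b              []             = b ∷ []
parseFrom b              (nothing ∷ w)  = b ∷ parseFrom nothing w
parseFrom nothing        (just c ∷ w)   = parseFrom (just (0 , c)) w
parseFrom (just (r , c)) (just _ ∷ w)   = parseFrom (just (suc r , c)) w

parse : List State → List Block
parse []            = []
parse (nothing ∷ w) = parseFrom nothing w
parse (just _ ∷ _)  = []

parseFrom-runFrom : ∀ r c r' c' w → parseFrom (just (r , c)) (runFrom r' c' ++ w) ≡ parseFrom (just (suc r' ℕ.+ r , c)) w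
parseFrom-runFrom r c zero     c' w = refl
parseFrom-runFrom r c (suc r') c' w =
  trans (parseFrom-runFrom (suc r) c r' (next c') w) (cong (λ x → parseFrom (just (suc x , c)) w) (ℕP.+-suc r' r))

parseFrom-run : ∀ b w → parseFrom nothing (run b ++ w) ≡ parseFrom b w
parseFrom-run nothing              w = refl
parseFrom-run (just (zero , c))    w = refl
parseFrom-run (just (suc r , c))   w =
  trans (parseFrom-runFrom 0 c r (next c) w) (cong (λ x → parseFrom (just (suc x , c)) w) (ℕP.+-identityʳ r))

parseFrom-encode : ∀ b cs → parseFrom b (encode cs) ≡ b ∷ cs
parseFrom-encode b []        = refl
parseFrom-encode b (b' ∷ cs) = cong (b ∷_) (trans (parseFrom-run b' (encode cs)) (parseFrom-encode b' cs))

parse-encode : ∀ cs → parse (encode cs) ≡ cs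
parse-encode []       = refl
parse-encode (b ∷ cs) = trans (parseFrom-run b (encode cs)) (parseFrom-encode b cs)

encode-injective : ∀ {cs cs'} → encode cs ≡ encode cs' → cs ≡ cs'
encode-injective {cs} {cs'} e = trans (sym (parse-encode cs)) (trans (cong parse e) (parse-encode cs'))

encode-parseFrom : ∀ w b → ChainFrom (lastOf b) w → encode (parseFrom b w) ≡ nothing ∷ run b ++ w
encode-parseFrom []            b              _       = refl
encode-parseFrom (nothing ∷ w) b              (_ , c) = cong (λ x → nothing ∷ (run b ++ x)) (encode-parseFrom w nothing c)
encode-parseFrom (just a ∷ w)  nothing        (_ , c) = encode-parseFrom w (just (0 , a)) c
encode-parseFrom (just a ∷ w)  (just (r , c)) (a≡ , ch) = begin
  encode (parseFrom (just (suc r , c)) w)          ≡⟨ encode-parseFrom w (just (suc r , c)) (subst (λ x → ChainFrom (just x) w) a≡' ch) ⟩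
  nothing ∷ runFrom (suc r) c ++ w                 ≡⟨ cong (λ x → nothing ∷ x ++ w) (runFrom-suc r c) ⟩
  nothing ∷ (runFrom r c ++ just last ∷ []) ++ w   ≡⟨ cong (nothing ∷_) (++-assoc (runFrom r c) (just last ∷ []) w) ⟩
  nothing ∷ runFrom r c ++ just last ∷ w           ≡⟨ cong (λ x → nothing ∷ runFrom r c ++ just x ∷ w) (sym a≡') ⟩
  nothing ∷ runFrom r c ++ just a ∷ w              ∎
  where
  open ≡-Reasoning
  last = iterate next c (suc r)
  a≡' : a ≡ last
  a≡' = trans a≡ (sym (iterate-suc r c))

encode-parse : ∀ p w → head w ≡ nothing → ChainFrom p w → encode (parse w) ≡ w
encode-parse p []            _ _       = refl
encode-parse p (nothing ∷ w) _ (_ , c) = encode-parseFrom w nothing c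

encode-++ : ∀ xs ys → encode (xs ++ ys) ≡ encode xs ++ encode ys
encode-++ []       ys = refl
encode-++ (b ∷ xs) ys =
  cong (nothing ∷_) (trans (cong (run b ++_) (encode-++ xs ys)) (sym (++-assoc (run b) (encode xs) (encode ys))))

encode-replicate : ∀ a → encode (replicate a nothing) ≡ replicate a nothing
encode-replicate zero    = refl
encode-replicate (suc a) = cong (nothing ∷_) (encode-replicate a)

encode-padded : ∀ cs a → encode (cs ++ replicate a nothing) ≡ encode cs ++ replicate a nothing
encode-padded cs a = trans (encode-++ cs (replicate a nothing)) (cong (encode cs ++_) (encode-replicate a))

weight-padded : ∀ m cs a → weight m (cs ++ replicate a nothing) ≡ weight m cs
weight-padded m (b ∷ cs) a = cong (m ℕ.* size b ℕ.+_) (weight-padded (suc m) cs a)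
weight-padded m []       a = empty m a
  where
  empty : ∀ m a → weight m (replicate a nothing) ≡ 0
  empty m zero    = refl
  empty m (suc a) rewrite ℕP.*-zeroʳ m = empty (suc m) a

totalSize-padded : ∀ cs a → totalSize (cs ++ replicate a nothing) ≡ totalSize cs
totalSize-padded (b ∷ cs) a = cong (size b ℕ.+_) (totalSize-padded cs a)
totalSize-padded []       a = empty a
  where
  empty : ∀ a → totalSize (replicate a nothing) ≡ 0
  empty zero    = refl
  empty (suc a) = empty a

weight-∷ʳ : ∀ m cs b → weight m (cs ∷ʳ b) ≡ weight m cs ℕ.+ (m ℕ.+ length cs) ℕ.* size b
weight-∷ʳ m []       b rewrite ℕP.+-identityʳ m = ℕP.+-identityʳ _
weight-∷ʳ m (x ∷ cs) b rewrite weight-∷ʳ (suc m) cs b | ℕP.+-suc m (length cs) =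
  sym (ℕP.+-assoc (m ℕ.* size x) (weight (suc m) cs) _)

SamePadded : List Block → List Block → Set
SamePadded cs cs' = Σ ℕ λ a → Σ ℕ λ a' → cs ++ replicate a nothing ≡ cs' ++ replicate a' nothing

module _ {cs cs'} (samePadded : SamePadded cs cs') where
  private
    a      = proj₁ samePadded
    a'     = proj₁ (proj₂ samePadded)
    padded = proj₂ (proj₂ samePadded)

  weight-SamePadded : ∀ m → weight m cs ≡ weight m cs'
  weight-SamePadded m = trans (sym (weight-padded m cs a)) (trans (cong (weight m) padded) (weight-padded m cs' a'))

  totalSize-SamePadded : totalSize cs ≡ totalSize cs'
  totalSize-SamePadded = trans (sym (totalSize-padded cs a)) (trans (cong totalSize padded) (totalSize-padded cs' a'))

  encode-SamePadded : encode cs ++ replicate a nothing ≡ encode cs' ++ replicate a' nothing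
  encode-SamePadded = trans (sym (encode-padded cs a)) (trans (cong encode padded) (encode-padded cs' a'))

light⇒empty : ∀ cs m B → weight m cs ≤ B → B < m → cs ≡ replicate (length cs) nothing
light⇒empty []                  m B _ _ = refl
light⇒empty (nothing ∷ cs)      m B w≤B B<m rewrite ℕP.*-zeroʳ m =
  cong (nothing ∷_) (light⇒empty cs (suc m) B w≤B (ℕP.m<n⇒m<1+n B<m))
light⇒empty (just (r , c) ∷ cs) m B w≤B B<m =
  ⊥-elim (ℕP.<-irrefl refl (ℕP.<-≤-trans B<m (ℕP.≤-trans (ℕP.m≤m*n m (suc r)) (ℕP.≤-trans (ℕP.m≤m+n _ _) w≤B))))

-- Blocks beyond position k are empty when the weight is at most k, so k blocks suffice.
resize : ∀ cs m k B → weight m cs ≤ B → B < m ℕ.+ k → Σ (List Block) λ cs' → length cs' ≡ k × SamePadded cs cs'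
resize cs       m zero    B w≤B B<m+0 =
  [] , refl , 0 , length cs , trans (++-identityʳ cs) (light⇒empty cs m B w≤B (subst (B <_) (ℕP.+-identityʳ m) B<m+0))
resize []       m (suc k) B _   _     = replicate (suc k) nothing , length-replicate (suc k) , suc k , 0 , sym (++-identityʳ _)
resize (b ∷ cs) m (suc k) B w≤B B<m+k
  with cs' , |cs'| , a , a' , padded ← resize cs (suc m) k B (ℕP.≤-trans (ℕP.m≤n+m _ _) w≤B) (subst (B <_) (ℕP.+-suc m k) B<m+k) =
  b ∷ cs' , cong suc |cs'| , a , a' , cong (b ∷_) padded

i<suc[i] : ∀ i → i ℤ.< ℤ.suc i
i<suc[i] i = ℤP.suc[i]≤j⇒i<j ℤP.≤-refl

<⇒<suc : ∀ {i s} → i ℤ.< s → i ℤ.< ℤ.suc s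
<⇒<suc {s = s} i<s = ℤP.<-≤-trans i<s (ℤP.i≤suc[i] s)

<suc∧≢⇒< : ∀ {i s} → i ℤ.< ℤ.suc s → i ≢ s → i ℤ.< s
<suc∧≢⇒< {i} {s} i<1+s i≢s =
  ℤP.≤∧≢⇒< (subst₂ ℤ._≤_ (ℤP.pred-suc i) (ℤP.pred-suc s) (ℤP.pred-mono (ℤP.i<j⇒suc[i]≤j i<1+s))) i≢s

suc-injective : ∀ {i j} → ℤ.suc i ≡ ℤ.suc j → i ≡ j
suc-injective {i} {j} e = trans (sym (ℤP.pred-suc i)) (trans (cong ℤ.pred e) (ℤP.pred-suc j))

+suc≡suc+ : ∀ s n → s ℤ.+ + suc n ≡ ℤ.suc s ℤ.+ + n
+suc≡suc+ s n = trans (cong (λ x → s ℤ.+ x) (ℤP.pos-+ 1 n)) (reassoc s (+ n))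
  where
  reassoc : ∀ s n → s ℤ.+ (ℤ.1ℤ ℤ.+ n) ≡ ℤ.1ℤ ℤ.+ s ℤ.+ n
  reassoc = ℤSolver.solve-∀

<+suc : ∀ s n → s ℤ.< s ℤ.+ + suc n
<+suc s n = subst (ℤ._< s ℤ.+ + suc n) (ℤP.+-identityʳ s) (ℤP.+-monoʳ-< s (ℤ.+<+ (s≤s z≤n)))

window-contains : ∀ s L E → ℤ.- (+ (∣ s ∣ ℕ.+ L ℕ.+ E)) ℤ.≤ s × s ℤ.+ + L ℤ.≤ + (∣ s ∣ ℕ.+ L ℕ.+ E)
window-contains (+ m)      L E = ℤP.neg-≤-pos , subst (ℤ._≤ + (m ℕ.+ L ℕ.+ E)) (ℤP.pos-+ m L) (ℤ.+≤+ (ℕP.m≤m+n (m ℕ.+ L) E))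
window-contains -[1+ m ]   L E =
  ℤ.-≤- (ℕP.≤-trans (ℕP.m≤m+n m L) (ℕP.m≤m+n (m ℕ.+ L) E)) ,
  ℤP.≤-trans (ℤP.+-monoˡ-≤ (+ L) (ℤ.-≤+ {m} {0})) (ℤ.+≤+ (ℕP.≤-trans (ℕP.m≤n+m L (suc m)) (ℕP.m≤m+n (suc m ℕ.+ L) E)))

below-window⇒negative : ∀ N i → i ℤ.< ℤ.- (+ N) → Σ ℕ λ k → i ≡ -[1+ k ] × N ≤ k
below-window⇒negative zero    -[1+ k ] _          = k , refl , z≤n
below-window⇒negative zero    (+ _)    (ℤ.+<+ ())
below-window⇒negative (suc N) -[1+ k ] (ℤ.-<- N<k) = k , refl , N<k

above-window⇒positive : ∀ N i → + N ℤ.≤ i → Σ ℕ λ k → i ≡ + k × N ≤ k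
above-window⇒positive N (+ k) (ℤ.+≤+ N≤k) = k , refl , N≤k

module Tail (τ : ℤ → State)
            (τ-compatible : ∀ i → Compatible (τ i) (τ (ℤ.suc i)))
            (τ-occupied : ∀ i → is-just (τ i) ≡ true) where

  place : ℤ → List State → ℤ → State
  place s []      i = if does (i ℤP.<? s) then τ i else nothing
  place s (t ∷ w) i = if does (i ℤP.≟ s) then t else place (ℤ.suc s) w i

  placedΩ : ℤ → List State → ℤ → Bool
  placedΩ s w i = is-just (place s w i)

  place-below : ∀ s w i → i ℤ.< s → place s w i ≡ τ i
  place-below s [] i i<s with i ℤP.<? s
  ... | yes _   = refl
  ... | no  i≮s = ⊥-elim (i≮s i<s)
  place-below s (t ∷ w) i i<s with i ℤP.≟ s
  ... | yes refl = ⊥-elim (ℤP.<-irrefl refl i<s)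
  ... | no  _    = place-below (ℤ.suc s) w i (<⇒<suc i<s)

  place-head : ∀ s w → place s w s ≡ head w
  place-head s [] with s ℤP.<? s
  ... | yes s<s = ⊥-elim (ℤP.<-irrefl refl s<s)
  ... | no  _   = refl
  place-head s (t ∷ w) with s ℤP.≟ s
  ... | yes _   = refl
  ... | no  s≢s = ⊥-elim (s≢s refl)

  place-∷-≢ : ∀ s t w i → i ≢ s → place s (t ∷ w) i ≡ place (ℤ.suc s) w i
  place-∷-≢ s t w i i≢s with i ℤP.≟ s
  ... | yes i≡s = ⊥-elim (i≢s i≡s)
  ... | no  _   = refl

  place-[]-≥ : ∀ s i → ¬ i ℤ.< s → place s [] i ≡ nothing
  place-[]-≥ s i i≮s with i ℤP.<? s
  ... | yes i<s = ⊥-elim (i≮s i<s)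
  ... | no  _   = refl

  place-above : ∀ s w i → s ℤ.+ + length w ℤ.≤ i → place s w i ≡ nothing
  place-above s [] i s≤i = place-[]-≥ s i (λ i<s → ℤP.<-irrefl refl (ℤP.<-≤-trans i<s (subst (ℤ._≤ i) (ℤP.+-identityʳ s) s≤i)))
  place-above s (t ∷ w) i s+|w|≤i with i ℤP.≟ s
  ... | yes refl = ⊥-elim (ℤP.<-irrefl refl (ℤP.<-≤-trans (<+suc i (length w)) s+|w|≤i))
  ... | no  _    = place-above (ℤ.suc s) w i (subst (ℤ._≤ i) (+suc≡suc+ s (length w)) s+|w|≤i)

  place-[]-suc : ∀ s i → i ≢ s → place (ℤ.suc s) [] i ≡ place s [] i
  place-[]-suc s i i≢s with i ℤP.<? s | i ℤP.<? ℤ.suc s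
  ... | yes _   | yes _     = refl
  ... | yes i<s | no  i≮1+s = ⊥-elim (i≮1+s (<⇒<suc i<s))
  ... | no  i≮s | yes i<1+s = ⊥-elim (i≮s (<suc∧≢⇒< i<1+s i≢s))
  ... | no  _   | no  _     = refl

  place-∷-tail : ∀ s t w → t ≡ τ s → ∀ i → place s (t ∷ w) i ≡ place (ℤ.suc s) w i
  place-∷-tail s t w t≡τs i with i ℤP.≟ s
  ... | yes refl = trans t≡τs (sym (place-below (ℤ.suc i) w i (i<suc[i] i)))
  ... | no  _    = refl

  placedΩ-∷-just : ∀ s a w i → placedΩ s (just a ∷ w) i ≡ placedΩ (ℤ.suc s) w i
  placedΩ-∷-just s a w i with i ℤP.≟ s
  ... | yes refl = sym (trans (cong is-just (place-below (ℤ.suc i) w i (i<suc[i] i))) (τ-occupied i))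
  ... | no  _    = refl

  place-compatible-inside : ∀ s w → Chain w → ∀ i → ℤ.suc i ≢ s → Compatible (place s w i) (place s w (ℤ.suc i))
  place-compatible-inside s [] _ i 1+i≢s with i ℤP.<? s | ℤ.suc i ℤP.<? s
  ... | yes _   | yes _     = τ-compatible i
  ... | yes i<s | no  1+i≮s = ⊥-elim (1+i≢s (ℤP.≤-antisym (ℤP.i<j⇒suc[i]≤j i<s) (ℤP.≮⇒≥ 1+i≮s)))
  ... | no  _   | _         = tt
  place-compatible-inside s (t ∷ w) chain i 1+i≢s rewrite place-∷-≢ s t w (ℤ.suc i) 1+i≢s with i ℤP.≟ s
  ... | yes refl rewrite place-head (ℤ.suc i) w = ChainFrom-head t w chain
  ... | no  i≢s  = place-compatible-inside (ℤ.suc s) w (ChainFrom⇒Chain t w chain) i (i≢s ∘′ suc-injective)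

  place-compatible : ∀ s w → ChainFrom (τ (ℤ.pred s)) w → ∀ i → Compatible (place s w i) (place s w (ℤ.suc i))
  place-compatible s w chain i with ℤ.suc i ℤP.≟ s
  ... | no  1+i≢s = place-compatible-inside s w (ChainFrom⇒Chain _ w chain) i 1+i≢s
  ... | yes refl rewrite place-head (ℤ.suc i) w | place-below (ℤ.suc i) w i (i<suc[i] i) | ℤP.pred-suc i =
    ChainFrom-head (τ i) w chain

  HasChargeEnergy : (ℤ → Bool) → ℕ → ℤ → ℤ → Set
  HasChargeEnergy S N c e = chargeN S N ≡ c × + energyN S N ≡ e

  tail-removes : ∀ s → Removes (placedΩ (ℤ.suc s) []) (placedΩ s []) s
  tail-removes s = record
    { in-S      = trans (cong is-just (place-below (ℤ.suc s) [] s (i<suc[i] s))) (τ-occupied s)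
    ; not-in-S' = cong is-just (place-head s [])
    ; same-else = λ i i≢s → cong is-just (place-[]-suc s i i≢s)
    }

  module _ (N : ℕ) (s : ℤ) (-N≤s : ℤ.- (+ N) ℤ.≤ s) (s<N : s ℤ.< + N) where
    private
      step = removal-chargeN-energyN N -N≤s s<N (tail-removes s)

    tail-up : HasChargeEnergy (placedΩ s []) N s (+ tri s) →
              HasChargeEnergy (placedΩ (ℤ.suc s) []) N (ℤ.suc s) (+ tri (ℤ.suc s))
    tail-up (c , e) = trans (proj₁ step) (trans (cong (ℤ._+ ℤ.1ℤ) c) (ℤP.+-comm s ℤ.1ℤ)) ,
                      trans (proj₂ step) (trans (cong (ℤ._+ s) e) (sym (tri-suc s)))

    tail-down : HasChargeEnergy (placedΩ (ℤ.suc s) []) N (ℤ.suc s) (+ tri (ℤ.suc s)) →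
                HasChargeEnergy (placedΩ s []) N s (+ tri s)
    tail-down (c , e) = ∙-cancelʳ ℤ.1ℤ _ _ (trans (sym (proj₁ step)) (trans c (ℤP.+-comm ℤ.1ℤ s))) ,
                        ∙-cancelʳ s _ _ (trans (sym (proj₂ step)) (trans e (tri-suc s)))

  tail-at-zero : ∀ N → HasChargeEnergy (placedΩ (+ 0) []) N (+ 0) (+ 0)
  tail-at-zero N = cong₂ (λ e p → + e ℤ.- + p) (sumTo-zero N (λ k _ → cong [_] (electron k)))
                                               (sumTo-zero N (λ k _ → cong (λ b → [ not b ]) (positron k))) ,
                   cong +_ (cong₂ ℕ._+_ (sumTo-zero N (λ k _ → cong (λ b → [ b ] ℕ.* k) (electron k)))
                                       (sumTo-zero N (λ k _ → cong (λ b → [ not b ] ℕ.* suc k) (positron k))))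
    where
    electron : ∀ k → placedΩ (+ 0) [] (+ k) ≡ false
    electron k = cong is-just (place-[]-≥ (+ 0) (+ k) (λ { (ℤ.+<+ ()) }))
    positron : ∀ k → placedΩ (+ 0) [] -[1+ k ] ≡ true
    positron k = trans (cong is-just (place-below (+ 0) [] -[1+ k ] ℤ.-<+)) (τ-occupied _)

  tail-chargeEnergy : ∀ N s → ℤ.- (+ N) ℤ.≤ s → s ℤ.≤ + N → HasChargeEnergy (placedΩ s []) N s (+ tri s)
  tail-chargeEnergy N (+ m) _ (ℤ.+≤+ m≤N) = upward m m≤N
    where
    upward : ∀ m → m ≤ N → HasChargeEnergy (placedΩ (+ m) []) N (+ m) (+ tri (+ m))
    upward zero    _   = tail-at-zero N
    upward (suc m) m<N = tail-up N (+ m) ℤP.neg-≤-pos (ℤ.+<+ m<N) (upward m (ℕP.<⇒≤ m<N))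
  tail-chargeEnergy N -[1+ m ] -N≤s _ = downward m -N≤s
    where
    downward : ∀ m → ℤ.- (+ N) ℤ.≤ -[1+ m ] → HasChargeEnergy (placedΩ -[1+ m ] []) N -[1+ m ] (+ tri -[1+ m ])
    downward zero    -N≤s = tail-down N -[1+ 0 ] -N≤s ℤ.-<+ (tail-at-zero N)
    downward (suc m) -N≤s = tail-down N -[1+ suc m ] -N≤s ℤ.-<+ (downward m (ℤP.≤-trans -N≤s (ℤ.-≤- (ℕP.n≤1+n m))))

  hole-removes : ∀ s w → Removes (placedΩ (ℤ.suc s) w) (placedΩ s (nothing ∷ w)) s
  hole-removes s w = record
    { in-S      = trans (cong is-just (place-below (ℤ.suc s) w s (i<suc[i] s))) (τ-occupied s)
    ; not-in-S' = cong is-just (place-head s (nothing ∷ w))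
    ; same-else = λ i i≢s → cong is-just (sym (place-∷-≢ s nothing w i i≢s))
    }

  placed-chargeEnergy : ∀ N w s → ℤ.- (+ N) ℤ.≤ s → s ℤ.+ + length w ℤ.≤ + N →
    HasChargeEnergy (placedΩ s w) N (s ℤ.+ + occupancy w) (+ tri (s ℤ.+ + occupancy w) ℤ.+ + inversions 0 w)
  placed-chargeEnergy N [] s -N≤s s≤N
    with c , e ← tail-chargeEnergy N s -N≤s (subst (ℤ._≤ + N) (ℤP.+-identityʳ s) s≤N) =
    trans c (sym (ℤP.+-identityʳ s)) ,
    trans e (sym (trans (cong (λ x → + tri x ℤ.+ + 0) (ℤP.+-identityʳ s)) (ℤP.+-identityʳ _)))
  placed-chargeEnergy N (just a ∷ w) s -N≤s s+|w|≤N
    with c , e ← placed-chargeEnergy N w (ℤ.suc s) (ℤP.i≤j⇒i≤1+j -N≤s) (subst (ℤ._≤ + N) (+suc≡suc+ s (length w)) s+|w|≤N) =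
    trans (chargeN-cong (placedΩ-∷-just s a w) N) (trans c (sym (+suc≡suc+ s (occupancy w)))) ,
    trans (cong +_ (energyN-cong (placedΩ-∷-just s a w) N))
          (trans e (cong (λ x → + tri x ℤ.+ + inversions 0 w) (sym (+suc≡suc+ s (occupancy w)))))
  placed-chargeEnergy N (nothing ∷ w) s -N≤s s+|w|≤N
    with c , e ← placed-chargeEnergy N w (ℤ.suc s) (ℤP.i≤j⇒i≤1+j -N≤s) (subst (ℤ._≤ + N) (+suc≡suc+ s (length w)) s+|w|≤N) =
    ∙-cancelʳ ℤ.1ℤ _ _ (trans (sym (proj₁ step)) (trans c (shift s o))) ,
    ∙-cancelʳ s _ _ (begin
      + energyN (placedΩ s (nothing ∷ w)) N ℤ.+ s                ≡⟨ proj₂ step ⟨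
      + energyN (placedΩ (ℤ.suc s) w) N                          ≡⟨ e ⟩
      + tri (ℤ.suc s ℤ.+ o) ℤ.+ + inversions 0 w                 ≡⟨ cong (λ x → + tri x ℤ.+ + inversions 0 w) (ℤP.+-assoc ℤ.1ℤ s o) ⟩
      + tri (ℤ.suc (s ℤ.+ o)) ℤ.+ + inversions 0 w               ≡⟨ cong (ℤ._+ + inversions 0 w) (tri-suc (s ℤ.+ o)) ⟩
      + tri (s ℤ.+ o) ℤ.+ (s ℤ.+ o) ℤ.+ + inversions 0 w         ≡⟨ rearrange (+ tri (s ℤ.+ o)) s o (+ inversions 0 w) ⟩
      + tri (s ℤ.+ o) ℤ.+ (+ inversions 0 w ℤ.+ o) ℤ.+ s         ≡⟨ cong (λ x → + tri (s ℤ.+ o) ℤ.+ x ℤ.+ s)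
                                                                       (trans (sym (ℤP.pos-+ (inversions 0 w) (occupancy w)))
                                                                              (cong +_ (sym (inversions-suc 0 w)))) ⟩
      + tri (s ℤ.+ o) ℤ.+ + inversions 1 w ℤ.+ s                 ∎)
    where
    open ≡-Reasoning
    o = + occupancy w
    step = removal-chargeN-energyN N -N≤s (ℤP.<-≤-trans (<+suc s (length w)) s+|w|≤N) (hole-removes s w)
    shift : ∀ s o → ℤ.1ℤ ℤ.+ s ℤ.+ o ≡ s ℤ.+ o ℤ.+ ℤ.1ℤ
    shift = ℤSolver.solve-∀
    rearrange : ∀ t s o i → t ℤ.+ (s ℤ.+ o) ℤ.+ i ≡ t ℤ.+ (i ℤ.+ o) ℤ.+ s
    rearrange = ℤSolver.solve-∀

  placedΩ-DiracBound : ∀ N w s → ℤ.- (+ N) ℤ.≤ s → s ℤ.+ + length w ℤ.≤ + N → DiracBound (placedΩ s w) N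
  placedΩ-DiracBound N w s -N≤s s+|w|≤N =
    (λ k k≥N → cong is-just (place-above s w (+ k) (ℤP.≤-trans s+|w|≤N (ℤ.+≤+ k≥N)))) ,
    (λ k k≥N → trans (cong is-just (place-below s w -[1+ k ] (ℤP.<-≤-trans (below-window N k k≥N) -N≤s))) (τ-occupied _))
    where
    below-window : ∀ N k → N ≤ k → -[1+ k ] ℤ.< ℤ.- (+ N)
    below-window zero    k _   = ℤ.-<+
    below-window (suc _) k N≤k = ℤ.-<- N≤k

  place-replicate : ∀ a s i → place s (replicate a nothing) i ≡ place s [] i
  place-replicate zero    s i = refl
  place-replicate (suc a) s i with i ℤP.≟ s
  ... | yes refl = sym (place-head i [])
  ... | no  i≢s  = trans (place-replicate a (ℤ.suc s) i) (place-[]-suc s i i≢s)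

  place-padded : ∀ w a s i → place s (w ++ replicate a nothing) i ≡ place s w i
  place-padded []      a s i = place-replicate a s i
  place-padded (t ∷ w) a s i with i ℤP.≟ s
  ... | yes _ = refl
  ... | no  _ = place-padded w a (ℤ.suc s) i

  place-injective : ∀ s w w' → (∀ i → place s w i ≡ place s w' i) → holes w ≡ holes w' → w ≡ w'
  place-injective s []      []       _    _     = refl
  place-injective s []      (t ∷ w') same holes≡ with trans (sym (place-head s [])) (trans (same s) (place-head s (t ∷ w')))
  place-injective s []      (.nothing ∷ w') same () | refl
  place-injective s (t ∷ w) []       same holes≡ with trans (sym (place-head s (t ∷ w))) (trans (same s) (place-head s []))
  place-injective s (.nothing ∷ w) [] same () | refl
  place-injective s (t ∷ w) (t' ∷ w') same holes≡ with trans (sym (place-head s (t ∷ w))) (trans (same s) (place-head s (t' ∷ w')))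
  ... | refl = cong (t ∷_) (place-injective (ℤ.suc s) w w' same-after (holes-tail t holes≡))
    where
    same-after : ∀ i → place (ℤ.suc s) w i ≡ place (ℤ.suc s) w' i
    same-after i with i ℤP.≟ s
    ... | yes refl = trans (place-below (ℤ.suc i) w i (i<suc[i] i)) (sym (place-below (ℤ.suc i) w' i (i<suc[i] i)))
    ... | no  i≢s  = trans (sym (place-∷-≢ s t w i i≢s)) (trans (same i) (place-∷-≢ s t w' i i≢s))
    holes-tail : ∀ t → holes (t ∷ w) ≡ holes (t ∷ w') → holes w ≡ holes w'
    holes-tail nothing  e = ℕP.suc-injective e
    holes-tail (just _) e = e

  τ≢nothing : ∀ i → τ i ≢ nothing
  τ≢nothing i e with trans (sym (cong is-just e)) (τ-occupied i)
  ... | ()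

  place-start-unique : ∀ s s' w w' → head w ≡ nothing → head w' ≡ nothing →
                       (∀ i → place s w i ≡ place s' w' i) → s ≡ s'
  place-start-unique s s' w w' w₀ w'₀ same with ℤP.<-cmp s s'
  ... | tri< s<s' _ _ = ⊥-elim (τ≢nothing s (trans (sym (place-below s' w' s s<s')) (trans (sym (same s)) (trans (place-head s w) w₀))))
  ... | tri≈ _ s≡s' _ = s≡s'
  ... | tri> _ _ s'<s = ⊥-elim (τ≢nothing s' (trans (sym (place-below s w s' s'<s)) (trans (same s') (trans (place-head s' w') w'₀))))

  τ-forced : ∀ s a → Compatible (τ (ℤ.pred s)) (just a) → just a ≡ τ s
  τ-forced s a c with τ (ℤ.pred s) in p | τ s in q
  ... | nothing | _       = ⊥-elim (τ≢nothing _ p)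
  ... | just _  | nothing = ⊥-elim (τ≢nothing _ q)
  ... | just t  | just t' = cong just (trans c (sym (subst₂ Compatible p (trans (cong τ (ℤP.suc-pred s)) q) (τ-compatible (ℤ.pred s)))))

  record Reduced (s : ℤ) (v : List State) : Set where
    field
      start   : ℤ
      word    : List State
      same    : ∀ i → place s v i ≡ place start word i
      chain   : ChainFrom (τ (ℤ.pred start)) word
      starts  : head word ≡ nothing

  -- A word continuing the tail can only repeat it until its first empty column.
  reduce : ∀ s v → ChainFrom (τ (ℤ.pred s)) v → Reduced s v
  reduce s []            c = record { start = s ; word = [] ; same = λ _ → refl ; chain = tt ; starts = refl }
  reduce s (nothing ∷ v) c = record { start = s ; word = nothing ∷ v ; same = λ _ → refl ; chain = c ; starts = refl }
  reduce s (just a ∷ v) (c , cv) = record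
    { start = start ; word = word ; chain = chain ; starts = starts
    ; same = λ i → trans (place-∷-tail s (just a) v forced i) (same i) }
    where
    forced = τ-forced s a c
    open Reduced (reduce (ℤ.suc s) v (subst (λ t → ChainFrom t v) (trans forced (cong τ (sym (ℤP.pred-suc s)))) cv))

  window : (ℤ → State) → ℤ → ℕ → List State
  window σ s zero    = []
  window σ s (suc L) = σ s ∷ window σ (ℤ.suc s) L

  place-window : ∀ σ L s i → s ℤ.≤ i → (s ℤ.+ + L ℤ.≤ i → σ i ≡ nothing) → place s (window σ s L) i ≡ σ i
  place-window σ zero s i s≤i empty =
    trans (place-[]-≥ s i (λ i<s → ℤP.<-irrefl refl (ℤP.<-≤-trans i<s s≤i)))
          (sym (empty (subst (ℤ._≤ i) (sym (ℤP.+-identityʳ s)) s≤i)))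
  place-window σ (suc L) s i s≤i empty with i ℤP.≟ s
  ... | yes refl = refl
  ... | no  i≢s  = place-window σ L (ℤ.suc s) i (ℤP.i<j⇒suc[i]≤j (ℤP.≤∧≢⇒< s≤i (i≢s ∘′ sym)))
                     (λ le → empty (subst (ℤ._≤ i) (sym (+suc≡suc+ s L)) le))

  window-chain : ∀ σ → (∀ i → Compatible (σ i) (σ (ℤ.suc i))) → ∀ L s → ChainFrom (σ (ℤ.pred s)) (window σ s L)
  window-chain σ compat zero    s = tt
  window-chain σ compat (suc L) s =
    subst (λ x → Compatible (σ (ℤ.pred s)) (σ x)) (ℤP.suc-pred s) (compat (ℤ.pred s)) ,
    subst (λ x → ChainFrom (σ x) (window σ (ℤ.suc s) L)) (ℤP.pred-suc s) (window-chain σ compat L (ℤ.suc s))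

  place-SamePadded : ∀ {cs cs'} → SamePadded cs cs' → ∀ s i → place s (encode cs) i ≡ place s (encode cs') i
  place-SamePadded {cs} {cs'} sp@(a , a' , _) s i =
    trans (sym (place-padded (encode cs) a s i))
          (trans (cong (λ w → place s w i) (encode-SamePadded sp)) (place-padded (encode cs') a' s i))

blocksOfSize : ℕ → List Block
blocksOfSize r = just (r , zero) ∷ just (r , suc zero) ∷ just (r , suc (suc zero)) ∷ []

blocksOfWeight : ℕ → ℕ → List Block
blocksOfWeight K zero    = nothing ∷ []
blocksOfWeight K (suc j) = if does (suc K ∣? suc j) then blocksOfSize (suc j / suc K ∸ 1) else []

≡ᵇ-refl : ∀ n → (n ≡ᵇ n) ≡ true
≡ᵇ-refl n = dec-true (n ℕ.≟ n) refl

onePlusTwoQ-vanishes : ∀ K i → i ≢ 0 → i ≢ suc K → onePlusTwoQ (suc K) i ≡ 0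
onePlusTwoQ-vanishes K zero    i≢0 _      = ⊥-elim (i≢0 refl)
onePlusTwoQ-vanishes K (suc i) _   i≢1+K rewrite dec-false (suc i ℕ.≟ suc K) i≢1+K = refl

factor-length-small : ∀ K j → j < suc K → factor K j ≡ length (blocksOfWeight K j)
factor-length-small K j j<1+K =
  trans (sumTo-single (suc j) 0 (s≤s z≤n) vanish) (trans (ℕP.+-identityʳ _) (invOneMinusQ-small j j<1+K))
  where
  vanish : ∀ i → i < suc j → i ≢ 0 → onePlusTwoQ (suc K) i ℕ.* invOneMinusQ K (j ∸ i) ≡ 0
  vanish i i≤j i≢0 rewrite onePlusTwoQ-vanishes K i i≢0 (λ { refl → ℕP.<-irrefl refl (ℕP.≤-<-trans (ℕP.≤-pred i≤j) j<1+K) }) = refl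
  invOneMinusQ-small : ∀ j → j < suc K → invOneMinusQ K j ≡ length (blocksOfWeight K j)
  invOneMinusQ-small zero    _     rewrite dec-true (suc K ∣? 0) (suc K ∣0) = refl
  invOneMinusQ-small (suc j) j<1+K rewrite dec-false (suc K ∣? suc j) (λ d → ℕP.<-irrefl refl (ℕP.<-≤-trans j<1+K (∣⇒≤ d))) = refl

-- Only the terms 1 and 2q^(K+1) of 1 + 2q^(K+1) contribute, and K+1 ∣ K+1+m iff K+1 ∣ m.
factor-length-large : ∀ K m → factor K (suc K ℕ.+ m) ≡ length (blocksOfWeight K (suc K ℕ.+ m))
factor-length-large K m = begin
  sumTo (suc j) F                                          ≡⟨ cong (λ n → sumTo n F) (sym (ℕP.+-suc (suc K) m)) ⟩
  sumTo (suc K ℕ.+ suc m) F                                ≡⟨ sumTo-+ (suc K) (suc m) F ⟩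
  sumTo (suc K) F ℕ.+ sumTo (suc m) (λ k → F (suc K ℕ.+ k)) ≡⟨ cong₂ ℕ._+_ (sumTo-single (suc K) 0 (s≤s z≤n) low)
                                                                          (sumTo-single (suc m) 0 (s≤s z≤n) high) ⟩
  F 0 ℕ.+ F (suc K ℕ.+ 0)                                  ≡⟨ cong (λ x → F 0 ℕ.+ F x) (ℕP.+-identityʳ (suc K)) ⟩
  F 0 ℕ.+ F (suc K)                                        ≡⟨ cong₂ ℕ._+_ (ℕP.+-identityʳ _)
                                                               (cong₂ ℕ._*_ (cong (λ b → if b then 2 else 0) (≡ᵇ-refl K))
                                                                            (cong (invOneMinusQ K) (ℕP.m+n∸m≡n (suc K) m))) ⟩
  invOneMinusQ K j ℕ.+ 2 ℕ.* invOneMinusQ K m              ≡⟨ count (suc K ∣? j) (suc K ∣? m) ⟩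
  length (blocksOfWeight K j)                              ∎
  where
  open ≡-Reasoning
  j = suc K ℕ.+ m
  F = λ i → onePlusTwoQ (suc K) i ℕ.* invOneMinusQ K (j ∸ i)
  low : ∀ i → i < suc K → i ≢ 0 → F i ≡ 0
  low i i<1+K i≢0 rewrite onePlusTwoQ-vanishes K i i≢0 (ℕP.<⇒≢ i<1+K) = refl
  high : ∀ k → k < suc m → k ≢ 0 → F (suc K ℕ.+ k) ≡ 0
  high zero    _ k≢0 = ⊥-elim (k≢0 refl)
  high (suc k) _ _   rewrite onePlusTwoQ-vanishes K (suc K ℕ.+ suc k) (λ ()) (ℕP.m+1+n≢m (suc K)) = refl
  count : (d₁ : Dec (suc K ∣ j)) (d₂ : Dec (suc K ∣ m)) →
          (if does d₁ then 1 else 0) ℕ.+ 2 ℕ.* (if does d₂ then 1 else 0) ≡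
          length (if does d₁ then blocksOfSize (j / suc K ∸ 1) else [])
  count (yes _)     (yes _)     = refl
  count (no _)      (no _)      = refl
  count (yes d∣j)   (no d∤m)    = ⊥-elim (d∤m (∣m+n∣m⇒∣n d∣j ∣-refl))
  count (no d∤j)    (yes d∣m)   = ⊥-elim (d∤j (∣m∣n⇒∣m+n ∣-refl d∣m))

factor-length : ∀ K j → factor K j ≡ length (blocksOfWeight K j)
factor-length K j with j ℕP.<? suc K
... | yes j<1+K = factor-length-small K j j<1+K
... | no  j≮1+K = subst (λ x → factor K x ≡ length (blocksOfWeight K x)) (ℕP.m+[n∸m]≡n (ℕP.≮⇒≥ j≮1+K))
                        (factor-length-large K (j ∸ suc K))

size-blocksOfSize : ∀ {r} b → b ∈ blocksOfSize r → size b ≡ suc r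
size-blocksOfSize _ (here refl)                 = refl
size-blocksOfSize _ (there (here refl))         = refl
size-blocksOfSize _ (there (there (here refl))) = refl

blocksOfWeight-sound : ∀ K j b → b ∈ blocksOfWeight K j → suc K ℕ.* size b ≡ j
blocksOfWeight-sound K zero    b (here refl) = ℕP.*-zeroʳ (suc K)
blocksOfWeight-sound K (suc j) b = sound (suc K ∣? suc j)
  where
  sound : (d : Dec (suc K ∣ suc j)) → b ∈ (if does d then blocksOfSize (suc j / suc K ∸ 1) else []) → suc K ℕ.* size b ≡ suc j
  sound (yes (divides (suc q) 1+j≡q*d)) b∈ = begin
    suc K ℕ.* size b                   ≡⟨ cong (suc K ℕ.*_) (size-blocksOfSize b b∈) ⟩
    suc K ℕ.* suc (suc j / suc K ∸ 1)  ≡⟨ cong (λ x → suc K ℕ.* suc (x ∸ 1)) quotient ⟩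
    suc K ℕ.* suc q                    ≡⟨ ℕP.*-comm (suc K) (suc q) ⟩
    suc q ℕ.* suc K                    ≡⟨ 1+j≡q*d ⟨
    suc j                              ∎
    where
    open ≡-Reasoning
    quotient : suc j / suc K ≡ suc q
    quotient = trans (cong (_/ suc K) 1+j≡q*d) (m*n/n≡m (suc q) (suc K))

blocksOfWeight-complete : ∀ K b → b ∈ blocksOfWeight K (suc K ℕ.* size b)
blocksOfWeight-complete K nothing        = subst (λ x → nothing ∈ blocksOfWeight K x) (sym (ℕP.*-zeroʳ (suc K))) (here refl)
blocksOfWeight-complete K (just (r , c)) = complete (suc K ∣? (suc K ℕ.* suc r))
  where
  ∈-blocksOfSize : ∀ c → just (r , c) ∈ blocksOfSize r
  ∈-blocksOfSize zero             = here refl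
  ∈-blocksOfSize (suc zero)       = there (here refl)
  ∈-blocksOfSize (suc (suc zero)) = there (there (here refl))
  d*r≡r*d : suc K ℕ.* suc r ≡ suc r ℕ.* suc K
  d*r≡r*d = ℕP.*-comm (suc K) (suc r)
  complete : (d : Dec (suc K ∣ suc K ℕ.* suc r)) →
             just (r , c) ∈ (if does d then blocksOfSize (suc K ℕ.* suc r / suc K ∸ 1) else [])
  complete (yes _)  = subst (λ x → just (r , c) ∈ blocksOfSize (x ∸ 1))
                            (sym (trans (cong (_/ suc K) d*r≡r*d) (m*n/n≡m (suc r) (suc K)))) (∈-blocksOfSize c)
  complete (no d∤)  = ⊥-elim (d∤ (divides (suc r) d*r≡r*d))

blocksOfWeight-unique : ∀ K j → Unique (blocksOfWeight K j)
blocksOfWeight-unique K zero    = [] ∷ []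
blocksOfWeight-unique K (suc j) = unique (suc K ∣? suc j)
  where
  unique : (d : Dec (suc K ∣ suc j)) → Unique (if does d then blocksOfSize (suc j / suc K ∸ 1) else [])
  unique (yes _) = ((λ ()) ∷ (λ ()) ∷ []) ∷ ((λ ()) ∷ []) ∷ [] ∷ []
  unique (no _)  = []

extensions : ℕ → ℕ → List (List Block) → List (List Block)
extensions K k′ css = cartesianProductWith _∷ʳ_ css (blocksOfWeight K k′)

blockLists : ℕ → ℕ → List (List Block)
blockLists zero    zero    = [] ∷ []
blockLists zero    (suc k) = []
blockLists (suc K) k       = concatUpTo (suc k) (λ j → extensions K (k ∸ j) (blockLists K j))

length-blockLists : ∀ K k → length (blockLists K k) ≡ prodUpTo K k
length-blockLists zero    zero    = refl
length-blockLists zero    (suc k) = refl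
length-blockLists (suc K) k       = trans (length-concatUpTo (suc k) _) (sumTo-cong (suc k) λ j _ →
  trans (length-cartesianProductWith _∷ʳ_ (blockLists K j) (blocksOfWeight K (k ∸ j)))
        (cong₂ ℕ._*_ (length-blockLists K j) (sym (factor-length K (k ∸ j)))))

blockLists-sound : ∀ K k {cs} → cs ∈ blockLists K k → length cs ≡ K × weight 1 cs ≡ k
blockLists-sound zero    zero    (here refl) = refl , refl
blockLists-sound (suc K) k       cs∈
  with j , j≤k , cs∈ⱼ ← ∈-concatUpTo⁻ (suc k) _ cs∈
  with cs₀ , b , cs₀∈ , b∈ , refl ← ∈-cartesianProductWith⁻ _∷ʳ_ (blockLists K j) (blocksOfWeight K (k ∸ j)) cs∈ⱼ
  with |cs₀| , weight-cs₀ ← blockLists-sound K j cs₀∈ =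
  trans (length-++ cs₀) (trans (cong (ℕ._+ 1) |cs₀|) (ℕP.+-comm K 1)) ,
  (begin
    weight 1 (cs₀ ∷ʳ b)                       ≡⟨ weight-∷ʳ 1 cs₀ b ⟩
    weight 1 cs₀ ℕ.+ suc (length cs₀) ℕ.* size b ≡⟨ cong₂ (λ w l → w ℕ.+ suc l ℕ.* size b) weight-cs₀ |cs₀| ⟩
    j ℕ.+ suc K ℕ.* size b                    ≡⟨ cong (j ℕ.+_) (blocksOfWeight-sound K (k ∸ j) b b∈) ⟩
    j ℕ.+ (k ∸ j)                             ≡⟨ ℕP.m+[n∸m]≡n (ℕP.≤-pred j≤k) ⟩
    k                                         ∎)
  where open ≡-Reasoning

blockLists-complete : ∀ K cs → length cs ≡ K → cs ∈ blockLists K (weight 1 cs)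
blockLists-complete zero    []  refl = here refl
blockLists-complete (suc K) cs  |cs| with initLast cs
... | cs₀ ∷ʳ′ b = subst (λ k → (cs₀ ∷ʳ b) ∈ blockLists (suc K) k) (sym weight≡) member
  where
  |cs₀| : length cs₀ ≡ K
  |cs₀| = ℕP.suc-injective (trans (trans (ℕP.+-comm 1 (length cs₀)) (sym (length-++ cs₀))) |cs|)
  j = weight 1 cs₀
  m = suc K ℕ.* size b
  weight≡ : weight 1 (cs₀ ∷ʳ b) ≡ j ℕ.+ m
  weight≡ = trans (weight-∷ʳ 1 cs₀ b) (cong (λ l → j ℕ.+ suc l ℕ.* size b) |cs₀|)
  b∈ : b ∈ blocksOfWeight K (j ℕ.+ m ∸ j)
  b∈ = subst (λ x → b ∈ blocksOfWeight K x) (sym (ℕP.m+n∸m≡n j m)) (blocksOfWeight-complete K b)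
  member : (cs₀ ∷ʳ b) ∈ blockLists (suc K) (j ℕ.+ m)
  member = ∈-concatUpTo⁺ (suc (j ℕ.+ m)) _ j (s≤s (ℕP.m≤m+n j m))
             (∈-cartesianProductWith⁺ _∷ʳ_ (blockLists-complete K cs₀ |cs₀|) b∈)

blockLists-unique : ∀ K k → Unique (blockLists K k)
blockLists-unique zero    zero    = [] ∷ []
blockLists-unique zero    (suc k) = []
blockLists-unique (suc K) k       = concatUpTo-unique (suc k) _
  (λ j → cartesianProductWith⁺ _∷ʳ_ (∷ʳ-injective _ _) (blockLists-unique K j) (blocksOfWeight-unique K (k ∸ j)))
  same-prefix-weight
  where
  same-prefix-weight : ∀ {i j cs} → cs ∈ extensions K (k ∸ i) (blockLists K i) → cs ∈ extensions K (k ∸ j) (blockLists K j) → i ≡ j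
  same-prefix-weight {i} {j} cs∈ᵢ cs∈ⱼ
    with cs₀ , _ , cs₀∈ , _ , refl ← ∈-cartesianProductWith⁻ _∷ʳ_ (blockLists K i) _ cs∈ᵢ
    with cs₁ , _ , cs₁∈ , _ , e    ← ∈-cartesianProductWith⁻ _∷ʳ_ (blockLists K j) _ cs∈ⱼ
    with refl , _ ← ∷ʳ-injective cs₀ cs₁ e =
    trans (sym (proj₂ (blockLists-sound K i cs₀∈))) (proj₂ (blockLists-sound K j cs₁∈))

rhsCoeff-≤ : ∀ n u → tri n ≤ u → rhsCoeff n u ≡ prodInf (u ∸ tri n)
rhsCoeff-≤ n u tri≤u = begin
  rhsCoeff n u                         ≡⟨ sumTo-single (suc u) k (s≤s (ℕP.m∸n≤m u (tri n))) vanish ⟩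
  prodInf k ℕ.* theta n (u ∸ k)        ≡⟨ cong (λ x → prodInf k ℕ.* theta n x) (ℕP.m∸[m∸n]≡n tri≤u) ⟩
  prodInf k ℕ.* theta n (tri n)        ≡⟨ cong (λ b → prodInf k ℕ.* (if b then 1 else 0)) (≡ᵇ-refl (tri n)) ⟩
  prodInf k ℕ.* 1                      ≡⟨ ℕP.*-identityʳ _ ⟩
  prodInf k                            ∎
  where
  open ≡-Reasoning
  k = u ∸ tri n
  vanish : ∀ j → j < suc u → j ≢ k → prodInf j ℕ.* theta n (u ∸ j) ≡ 0
  vanish j j≤u j≢k
    rewrite dec-false (u ∸ j ℕ.≟ tri n) (λ e → j≢k (trans (sym (ℕP.m∸[m∸n]≡n (ℕP.≤-pred j≤u))) (cong (u ∸_) e))) =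
    ℕP.*-zeroʳ (prodInf j)

rhsCoeff-≰ : ∀ n u → ¬ tri n ≤ u → rhsCoeff n u ≡ 0
rhsCoeff-≰ n u tri≰u = sumTo-zero (suc u) vanish
  where
  vanish : ∀ j → j < suc u → prodInf j ℕ.* theta n (u ∸ j) ≡ 0
  vanish j _ rewrite dec-false (u ∸ j ℕ.≟ tri n) (λ e → tri≰u (subst (_≤ u) e (ℕP.m∸n≤m u j))) = ℕP.*-zeroʳ (prodInf j)

module Ĉ (T : VSet) (T-config : IsConfiguration T) (T-full : ∀ i → Ω T i ≡ true) where

  τ : ℤ → State
  τ = stateOf T

  τ-occupied : ∀ i → is-just (τ i) ≡ true
  τ-occupied i = trans (sym (Ω-stateOf T i)) (T-full i)

  open Tail τ (stateOf-compatible T T-config) τ-occupied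

  place-EventuallyAgree : ∀ s w → EventuallyAgree (toVSet (place s w)) T
  place-EventuallyAgree s w = ∣ s ∣ , λ k k≥ a → trans (cong (λ x → occupies x a) (place-below s w -[1+ k ] (below s k k≥)))
                                                      (sym (toVSet-stateOf T T-config -[1+ k ] a))
    where
    below : ∀ s k → k ℕ.≥ ∣ s ∣ → -[1+ k ] ℤ.< s
    below (+ _)      k _  = ℤ.-<+
    below -[1+ m ]   k k≥ = ℤ.-<- k≥

  realize : ℤ → List Block → VSet
  realize n cs = toVSet (place (n ℤ.- + totalSize cs) (encode cs))

  realize-InĈ : ∀ n u cs → tri n ℕ.+ weight 1 cs ≡ u → InĈ T (realize n cs) n u
  realize-InĈ n u cs e =
    toVSet-isConfiguration (place s w) (place-compatible s w (encode-chain _ cs)) ,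
    place-EventuallyAgree s w ,
    N , DiracBound-cong Ω≡ N (placedΩ-DiracBound N w s -N≤s s+|w|≤N) ,
    trans (chargeN-cong Ω≡ N) (trans c charge≡) ,
    ℤP.+-injective (trans (cong +_ (energyN-cong Ω≡ N)) (trans ε energy≡))
    where
    s = n ℤ.- + totalSize cs
    w = encode cs
    N = ∣ s ∣ ℕ.+ length w ℕ.+ 0
    -N≤s = proj₁ (window-contains s (length w) 0)
    s+|w|≤N = proj₂ (window-contains s (length w) 0)
    Ω≡ : ∀ i → Ω (toVSet (place s w)) i ≡ placedΩ s w i
    Ω≡ = Ω-toVSet (place s w)
    ce = placed-chargeEnergy N w s -N≤s s+|w|≤N
    c = proj₁ ce
    ε = proj₂ ce
    charge≡ : s ℤ.+ + occupancy w ≡ n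
    charge≡ = trans (cong (λ x → s ℤ.+ + x) (occupancy-encode cs)) (//-rightDividesˡ (+ totalSize cs) n)
    energy≡ : + tri (s ℤ.+ + occupancy w) ℤ.+ + inversions 0 w ≡ + u
    energy≡ = trans (cong₂ (λ x y → + tri x ℤ.+ + y) charge≡ (inversions-encode 0 cs))
                    (trans (sym (ℤP.pos-+ (tri n) (weight 1 cs))) (cong +_ e))

  realize-injective : ∀ n cs cs' → length cs ≡ length cs' → SameSet (realize n cs) (realize n cs') → cs ≡ cs'
  realize-injective n cs cs' |cs|≡ same = encode-injective (place-injective s (encode cs) (encode cs') same′ holes≡)
    where
    s = n ℤ.- + totalSize cs
    s' = n ℤ.- + totalSize cs'
    placed≡ : ∀ i → place s (encode cs) i ≡ place s' (encode cs') i
    placed≡ = toVSet-injective _ _ same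
    s≡s' = place-start-unique s s' (encode cs) (encode cs') (head-encode cs) (head-encode cs') placed≡
    same′ : ∀ i → place s (encode cs) i ≡ place s (encode cs') i
    same′ i = trans (placed≡ i) (cong (λ x → place x (encode cs') i) (sym s≡s'))
    holes≡ : holes (encode cs) ≡ holes (encode cs')
    holes≡ = trans (holes-encode cs) (trans |cs|≡ (sym (holes-encode cs')))

  record PlacedForm (χ : VSet) : Set where
    field
      start  : ℤ
      word   : List State
      same   : ∀ i → stateOf χ i ≡ place start word i
      chain  : ChainFrom (τ (ℤ.pred start)) word
      starts : head word ≡ nothing

  placedForm : ∀ χ → IsConfiguration χ → EventuallyAgree χ T → IsDirac (Ω χ) → PlacedForm χ
  placedForm χ config (M , agree) (N₀ , above , _) = record
    { start = start ; word = word ; chain = chain ; starts = starts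
    ; same = λ i → trans (σ≡window i) (same i) }
    where
    σ = stateOf χ
    N = N₀ ℕ.+ M
    s₀ = ℤ.- (+ N)
    L = N ℕ.+ N
    tail-below : ∀ i → i ℤ.< s₀ → σ i ≡ τ i
    tail-below i i<s₀ with k , refl , N≤k ← below-window⇒negative N i i<s₀ =
      stateOf-cong χ T _ (agree k (ℕP.≤-trans (ℕP.m≤n+m M N₀) N≤k))
    s₀+L≡N : s₀ ℤ.+ + L ≡ + N
    s₀+L≡N = trans (cong (λ x → s₀ ℤ.+ x) (ℤP.pos-+ N N)) (cancel (+ N))
      where
      cancel : ∀ a → ℤ.- a ℤ.+ (a ℤ.+ a) ≡ a
      cancel = ℤSolver.solve-∀
    empty-above : ∀ i → s₀ ℤ.+ + L ℤ.≤ i → σ i ≡ nothing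
    empty-above i s₀+L≤i with k , refl , N≤k ← above-window⇒positive N i (subst (ℤ._≤ i) s₀+L≡N s₀+L≤i) =
      is-just≡false (trans (sym (Ω-stateOf χ (+ k))) (above k (ℕP.≤-trans (ℕP.m≤m+n N₀ M) N≤k)))
      where
      is-just≡false : ∀ {s : State} → is-just s ≡ false → s ≡ nothing
      is-just≡false {nothing} _ = refl
    σ≡window : ∀ i → σ i ≡ place s₀ (window σ s₀ L) i
    σ≡window i with i ℤP.<? s₀
    ... | yes i<s₀ = trans (tail-below i i<s₀) (sym (place-below s₀ (window σ s₀ L) i i<s₀))
    ... | no  i≮s₀ = sym (place-window σ L s₀ i (ℤP.≮⇒≥ i≮s₀) (empty-above i))
    window-chain′ : ChainFrom (τ (ℤ.pred s₀)) (window σ s₀ L)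
    window-chain′ = subst (λ t → ChainFrom t (window σ s₀ L)) (tail-below _ (ℤP.i≤pred[j]⇒i<j ℤP.≤-refl))
                          (window-chain σ (stateOf-compatible χ config) L s₀)
    open Reduced (reduce s₀ (window σ s₀ L) window-chain′)

  placedForm-chargeEnergy : ∀ χ (p : PlacedForm χ) N₀ → DiracBound (Ω χ) N₀ → let open PlacedForm p in
    HasChargeEnergy (Ω χ) N₀ (start ℤ.+ + occupancy word) (+ tri (start ℤ.+ + occupancy word) ℤ.+ + inversions 0 word)
  placedForm-chargeEnergy χ p N₀ bound =
    trans (sym (chargeN-stable (Ω χ) bound N₀≤N)) (trans (chargeN-cong Ω≡ N) (proj₁ ce)) ,
    trans (cong +_ (sym (energyN-stable (Ω χ) bound N₀≤N))) (trans (cong +_ (energyN-cong Ω≡ N)) (proj₂ ce))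
    where
    open PlacedForm p
    N = ∣ start ∣ ℕ.+ length word ℕ.+ N₀
    N₀≤N = ℕP.m≤n+m N₀ (∣ start ∣ ℕ.+ length word)
    Ω≡ : ∀ i → Ω χ i ≡ placedΩ start word i
    Ω≡ i = trans (Ω-stateOf χ i) (cong is-just (same i))
    ce = placed-chargeEnergy N word start (proj₁ (window-contains start (length word) N₀))
                                          (proj₂ (window-contains start (length word) N₀))

  record Decoding (χ : VSet) (n : ℤ) (u : ℕ) : Set where
    field
      blocks       : List Block
      energy-split : tri n ℕ.+ weight 1 blocks ≡ u
      realizes     : SameSet χ (realize n blocks)

  decode : ∀ χ n u → InĈ T χ n u → Decoding χ n u
  decode χ n u (config , agree , N₀ , bound , charge , energy) =
    record { blocks = cs ; energy-split = energy≡ ; realizes = realizes }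
    where
    p = placedForm χ config agree (N₀ , bound)
    open PlacedForm p
    cs = parse word
    encoded : encode cs ≡ word
    encoded = encode-parse _ word starts chain
    ce = placedForm-chargeEnergy χ p N₀ bound
    charge≡ : start ℤ.+ + totalSize cs ≡ n
    charge≡ = trans (cong (λ o → start ℤ.+ + o) (trans (sym (occupancy-encode cs)) (cong occupancy encoded)))
                    (trans (sym (proj₁ ce)) charge)
    energy≡ : tri n ℕ.+ weight 1 cs ≡ u
    energy≡ = ℤP.+-injective (begin
      + (tri n ℕ.+ weight 1 cs)                                ≡⟨ ℤP.pos-+ (tri n) (weight 1 cs) ⟩
      + tri n ℤ.+ + weight 1 cs                                ≡⟨ cong₂ (λ c w → + tri c ℤ.+ + w)
                                                                   (trans (sym charge≡) (cong (λ o → start ℤ.+ + o) occupancy≡))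
                                                                   (trans (sym (inversions-encode 0 cs)) (cong (inversions 0) encoded)) ⟩
      + tri (start ℤ.+ + occupancy word) ℤ.+ + inversions 0 word ≡⟨ proj₂ ce ⟨
      + energyN (Ω χ) N₀                                       ≡⟨ cong +_ energy ⟩
      + u                                                      ∎)
      where
      open ≡-Reasoning
      occupancy≡ : totalSize cs ≡ occupancy word
      occupancy≡ = trans (sym (occupancy-encode cs)) (cong occupancy encoded)
    realizes : SameSet χ (realize n cs)
    realizes i a = trans (toVSet-stateOf χ config i a) (cong (λ x → occupies x a) (begin
      stateOf χ i                                ≡⟨ same i ⟩
      place start word i                         ≡⟨ cong (λ w → place start w i) (sym encoded) ⟩
      place start (encode cs) i                  ≡⟨ cong (λ s → place s (encode cs) i) (sym (//-rightDividesʳ (+ totalSize cs) start)) ⟩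
      place (start ℤ.+ + totalSize cs ℤ.- + totalSize cs) (encode cs) i
                                                 ≡⟨ cong (λ c → place (c ℤ.- + totalSize cs) (encode cs) i) charge≡ ⟩
      place (n ℤ.- + totalSize cs) (encode cs) i ∎))
      where open ≡-Reasoning

  realize-SamePadded : ∀ n {cs cs'} → SamePadded cs cs' → SameSet (realize n cs) (realize n cs')
  realize-SamePadded n {cs} {cs'} sp i a = cong (λ x → occupies x a) (begin
    place (n ℤ.- + totalSize cs) (encode cs) i   ≡⟨ cong (λ t → place (n ℤ.- + t) (encode cs) i) (totalSize-SamePadded sp) ⟩
    place (n ℤ.- + totalSize cs') (encode cs) i  ≡⟨ place-SamePadded sp _ i ⟩
    place (n ℤ.- + totalSize cs') (encode cs') i ∎)
    where open ≡-Reasoning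

  module _ (n : ℤ) (k : ℕ) where

    realizations : List VSet
    realizations = map (realize n) (blockLists k k)

    realizations-sound : ∀ u → tri n ℕ.+ k ≡ u → All (λ χ → InĈ T χ n u) realizations
    realizations-sound u e = All.map⁺ (All.tabulate λ {cs} cs∈ →
      realize-InĈ n u cs (trans (cong (tri n ℕ.+_) (proj₂ (blockLists-sound k k cs∈))) e))

    realizations-distinct : AllPairs (λ χ χ' → ¬ SameSet χ χ') realizations
    realizations-distinct = AllPairs.map⁺ (AllPairs-mapWith distinct (All.tabulate (λ cs∈ → proj₁ (blockLists-sound k k cs∈)))
                                                            (blockLists-unique k k))
      where
      distinct : ∀ {cs cs'} → length cs ≡ k → length cs' ≡ k → cs ≢ cs' → ¬ SameSet (realize n cs) (realize n cs')
      distinct |cs| |cs'| cs≢cs' same = cs≢cs' (realize-injective n _ _ (trans |cs| (sym |cs'|)) same)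

    realizations-complete : ∀ χ {u} → InĈ T χ n u → tri n ℕ.+ k ≡ u → Any (SameSet χ) realizations
    realizations-complete χ {u} χ∈ e = lose (∈-map⁺ (realize n) cs∈) (λ i a → trans (realizes i a) (realize-SamePadded n padded i a))
      where
      open Decoding (decode χ n u χ∈)
      weight≡k : weight 1 blocks ≡ k
      weight≡k = ℕP.+-cancelˡ-≡ (tri n) _ _ (trans energy-split (sym e))
      resized = resize blocks 1 k k (ℕP.≤-reflexive weight≡k) (ℕP.n<1+n k)
      cs = proj₁ resized
      padded = proj₂ (proj₂ resized)
      cs∈ : cs ∈ blockLists k k
      cs∈ = subst (λ w → cs ∈ blockLists k w) (trans (sym (weight-SamePadded padded 1)) weight≡k)
                  (blockLists-complete k cs (proj₁ (proj₂ resized)))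

  InĈ-cardinality : (n : ℤ) (u : ℕ) → HasCardinality (λ χ → InĈ T χ n u) (rhsCoeff n u)
  InĈ-cardinality n u with tri n ℕP.≤? u
  ... | no tri≰u = [] , sym (rhsCoeff-≰ n u tri≰u) , [] , [] , λ χ χ∈ →
    ⊥-elim (tri≰u (subst (tri n ≤_) (Decoding.energy-split (decode χ n u χ∈)) (ℕP.m≤m+n (tri n) _)))
  ... | yes tri≤u = realizations n k , length≡ , realizations-sound n k u tri+k≡u , realizations-distinct n k ,
                    λ χ χ∈ → realizations-complete n k χ χ∈ tri+k≡u
    where
    k = u ∸ tri n
    tri+k≡u = ℕP.m+[n∸m]≡n tri≤u
    length≡ : length (realizations n k) ≡ rhsCoeff n u
    length≡ = trans (length-map (realize n) (blockLists k k)) (trans (length-blockLists k k) (sym (rhsCoeff-≤ n u tri≤u)))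

proposition7 : (T : VSet) → IsConfiguration T → (∀ i → Ω T i ≡ true) →
    (n : ℤ) (u : ℕ) → HasCardinality (λ χ → InĈ T χ n u) (rhsCoeff n u)
proposition7 T T-config T-full = Ĉ.InĈ-cardinality T T-config T-full
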